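{- Let $K$ be a unital commutative $\mathbb{Q}$-algebra and $\alpha\ge1$. In both the commutative and the noncommutative case, for every nonzero $P\in{\mathcal N}Sym$ there exist $n\ge1$ and $F_t(z)\in\mathbb{B}_t^{[\alpha]}\langle z\rangle$ (with $z=(z_1,\dots,z_n)$) such that $\mathcal{S}_{F_t}(P)\ne0$.
   Context: $z=(z_1,\dots,z_n)$ free variables, all commutative or all noncommutative; $t$ central. $\mathbb{B}_t^{[\alpha]}\langle z\rangle$ is the set of automorphisms $F_t=z-H_t(z)$ of the polynomial algebra $K[t]\langle z\rangle$ over $K[t]$ such that $H_{t=0}(z)=0$, $H_t(z)$ is homogeneous in $z$ of some degree $d\ge\alpha$, and, after a suitable permutation of the variables, the Jacobian matrix $JH_t(z)$ is strictly lower triangular. Such $F_t$ is regarded as an automorphism of $K[[t]]\langle\langle z\rangle\rangle$. $[u\,\partial/\partial z]$ is the $K$-derivation $z_i\mapsto u_i$; $\mathcal{D}^{[\alpha]}\langle\langle z\rangle\rangle$ is the unital subalgebra of $\mathrm{End}_K(K\langle\langle z\rangle\rangle)$ generated by the derivations increasing degree by at least $\alpha-1$. ${\mathcal N}Sym$ is the free associative $K$-algebra on $\Lambda_1,\Lambda_2,\dots$; $\mathcal{S}_{F_t}:{\mathcal N}Sym\to\mathcal{D}^{[\alpha]}\langle\langle z\rangle\rangle$ is the $K$-algebra homomorphism with $\sum_{m\ge0}t^m\mathcal{S}_{F_t}(\Lambda_m)=f(t)$ ($\Lambda_0=1$), where $f(t)\in\mathcal{D}^{[\alpha]}\langle\langle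 z\rangle\rangle[[t]]$ is the unique element with $f(0)=1$ and $f(-t)u_t(z)=u_t(F_t)$ for all $u_t\in K[[t]]\langle\langle z\rangle\rangle$. -}

module Defs where

open import Level using (Level; _⊔_)
open import Algebra.Bundles using (CommutativeRing)
open import Data.Nat as ℕ using (ℕ; zero; suc; _∸_; _≤_)
open import Data.Fin as Fin using (Fin)
open import Data.Fin.Permutation using (Permutation′; _⟨$⟩ʳ_)
open import Data.List as List using (List; []; _∷_; _++_; [_]; concatMap; upTo; allFin; foldr)
open import Data.Vec as Vec using (Vec; []; _∷_; lookup; updateAt; zipWith; replicate)
import Data.List.Properties as LP
import Data.Vec.Properties as VP
open import Data.Product using (Σ; ∃; ∃-syntax; _×_; _,_; proj₁; proj₂)
open import Relation.Binary.PropositionalEquality using (_≡_)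
open import Relation.Nullary using (¬_; yes; no)
open import Relation.Binary.Definitions using (DecidableEquality)

data Case : Set where
  comm noncomm : Case

-- monomials in z: exponent vectors (commutative) / words (noncommutative)
Mon : Case → ℕ → Set
Mon comm    n = Vec ℕ n
Mon noncomm n = List (Fin n)

degree : ∀ {c n} → Mon c n → ℕ
degree {comm}    m = Vec.foldr _ ℕ._+_ 0 m
degree {noncomm} m = List.length m

oneMon : ∀ {c n} → Mon c n
oneMon {comm}    = replicate _ 0
oneMon {noncomm} = []

varMon : ∀ {c n} → Fin n → Mon c n
varMon {comm}    i = updateAt (replicate _ 0) i suc
varMon {noncomm} i = [ i ]

_·M_ : ∀ {c n} → Mon c n → Mon c n → Mon c n
_·M_ {comm}    m m' = zipWith ℕ._+_ m m'
_·M_ {noncomm} m m' = m ++ m'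

_≟M_ : ∀ {c n} → DecidableEquality (Mon c n)
_≟M_ {comm}    = VP.≡-dec ℕ._≟_
_≟M_ {noncomm} = LP.≡-dec Fin._≟_

letters : ∀ {c n} → Mon c n → List (Fin n)
letters {noncomm} m = m
letters {comm} {n} m = concatMap (λ i → List.replicate (lookup m i) i) (allFin n)

-- all monomials of degree ≤ N, each listed exactly once
private
  wordsOfLen : ∀ n → ℕ → List (List (Fin n))
  wordsOfLen n zero    = [] ∷ []
  wordsOfLen n (suc L) = concatMap (λ i → List.map (i ∷_) (wordsOfLen n L)) (allFin n)

  vecsLe : ∀ n → ℕ → List (Vec ℕ n)
  vecsLe zero    N = [] ∷ []
  vecsLe (suc n) N = concatMap (λ a → List.map (a ∷_) (vecsLe n (N ∸ a))) (upTo (suc N))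

monsUpTo : ∀ c n → ℕ → List (Mon c n)
monsUpTo comm    n N = vecsLe n N
monsUpTo noncomm n N = concatMap (wordsOfLen n) (upTo (suc N))

module Over {a ℓ} (K : CommutativeRing a ℓ) where
  open CommutativeRing K

  sumK : List Carrier → Carrier
  sumK = foldr _+_ 0#

  ι : ℕ → Carrier
  ι zero    = 0#
  ι (suc n) = 1# + ι n

  negPow : ℕ → Carrier → Carrier
  negPow zero    x = x
  negPow (suc k) x = - negPow k x

  -- K is a Q-algebra: every positive integer is invertible in K
  IsQAlgebra : Set (a ⊔ ℓ)
  IsQAlgebra = ∀ n → ∃[ y ] (ι (suc n) * y ≈ 1#)

  -- Polynomials in K[t]⟨z⟩ (resp. K[t][z]): finite lists of terms
  -- c · t^k · z^m ; the polynomial is the sum of its terms.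

  record Term (c : Case) (n : ℕ) : Set a where
    constructor term
    field
      coef : Carrier
      tpow : ℕ
      mon  : Mon c n

  Poly : Case → ℕ → Set a
  Poly c n = List (Term c n)

  coeff : ∀ {c n} → Poly c n → ℕ → Mon c n → Carrier
  coeff []                  k m = 0#
  coeff (term x j m' ∷ p) k m with j ℕ.≟ k | m' ≟M m
  ... | yes _ | yes _ = x + coeff p k m
  ... | _     | _     = coeff p k m

  _≐P_ : ∀ {c n} → Poly c n → Poly c n → Set ℓ
  p ≐P q = ∀ k m → coeff p k m ≈ coeff q k m

  oneP : ∀ {c n} → Poly c n
  oneP = term 1# 0 oneMon ∷ []

  varP : ∀ {c n} → Fin n → Poly c n
  varP i = term 1# 0 (varMon i) ∷ []

  negP : ∀ {c n} → Poly c n → Poly c n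
  negP = List.map (λ { (term x k m) → term (- x) k m })

  _+P_ : ∀ {c n} → Poly c n → Poly c n → Poly c n
  _+P_ = _++_

  _*P_ : ∀ {c n} → Poly c n → Poly c n → Poly c n
  p *P q = concatMap (λ { (term x k m) →
             List.map (λ { (term y l m') → term (x * y) (k ℕ.+ l) (m ·M m') }) q }) p

  -- a polynomial map (endomorphism of K[t]⟨z⟩ over K[t]) given by images of z_i
  PolyMap : Case → ℕ → Set a
  PolyMap c n = Fin n → Poly c n

  monAt : ∀ {c n} → PolyMap c n → Mon c n → Poly c n
  monAt G m = foldr (λ i r → G i *P r) oneP (letters m)

  substP : ∀ {c n} → PolyMap c n → Poly c n → Poly c n
  substP G p = concatMap (λ { (term x k m) →
                 (term x k oneMon ∷ []) *P monAt G m }) p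

  idMap : ∀ {c n} → PolyMap c n
  idMap = varP

  IsAutomorphism : ∀ {c n} → PolyMap c n → Set (a ⊔ ℓ)
  IsAutomorphism {c} {n} F =
    ∃[ G ] ((∀ i → substP G (F i) ≐P varP i) × (∀ i → substP F (G i) ≐P varP i))

  -- Jacobian entries ∂p/∂z_j = 0.
  -- commutative: usual partial derivative, coefficient of t^k z^m is
  --   (m_j + 1) · coeff p (m + e_j);
  -- noncommutative: the (double) derivative with values in K[t]⟨z⟩⊗K⟨z⟩,
  --   coefficient of t^k u⊗v is coeff p (u z_j v).
  JacEntryZero : ∀ {c n} → Poly c n → Fin n → Set ℓ
  JacEntryZero {comm}    p j = ∀ k (m : Vec ℕ _) →
    ι (suc (lookup m j)) * coeff p k (updateAt m j suc) ≈ 0#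
  JacEntryZero {noncomm} p j = ∀ k (u v : List (Fin _)) →
    coeff p k (u ++ j ∷ v) ≈ 0#

  record 𝔹 (c : Case) (α n : ℕ) : Set (a ⊔ ℓ) where
    field
      H         : PolyMap c n
      d         : ℕ
      α≤d       : α ≤ d
      homog     : ∀ i k m → ¬ (degree m ≡ d) → coeff (H i) k m ≈ 0#
      vanish-t0 : ∀ i m → coeff (H i) 0 m ≈ 0#
      -- after a permutation σ of the variables, JH is strictly lower triangular
      σ         : Permutation′ n
      triangular : ∀ i j → ¬ ((σ ⟨$⟩ʳ j) Fin.< (σ ⟨$⟩ʳ i)) → JacEntryZero (H i) j
      auto      : IsAutomorphism (λ i → varP i +P negP (H i))

    F : PolyMap c n
    F i = varP i +P negP (H i)

  -- Formal power series K⟨⟨z⟩⟩ and K[[t]]⟨⟨z⟩⟩ as coefficient functions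

  Series : Case → ℕ → Set a
  Series c n = Mon c n → Carrier

  TSeries : Case → ℕ → Set a
  TSeries c n = ℕ → Mon c n → Carrier

  -- u_t(F_t) for F_t without constant term in z (true for F_t ∈ 𝔹):
  -- the coefficient of t^k z^m only involves monomials z^v with |v| ≤ |m|.
  compose : ∀ {c n} → TSeries c n → PolyMap c n → TSeries c n
  compose {c} {n} u F k m =
    sumK (List.map (λ b →
      sumK (List.map (λ v → u b v * coeff (monAt F v) (k ∸ b) m)
                     (monsUpTo c n (degree m))))
      (upTo (suc k)))

  record IsLinearOp {c n} (φ : Series c n → Series c n) : Set (a ⊔ ℓ) where
    field
      cong-op : ∀ u v → (∀ m → u m ≈ v m) → ∀ m → φ u m ≈ φ v m
      additive : ∀ u v m → φ (λ w → u w + v w) m ≈ φ u m + φ v m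
      homogen  : ∀ (x : Carrier) u m → φ (λ w → x * u w) m ≈ x * φ u m

  -- f(t) = Σ_m t^m f_m with f(0) = 1 and f(-t) u_t(z) = u_t(F_t) for all u_t
  record IsGenerator {c n} (F : PolyMap c n)
                     (f : ℕ → Series c n → Series c n) : Set (a ⊔ ℓ) where
    field
      linear : ∀ k → IsLinearOp (f k)
      f0     : ∀ u m → f 0 u m ≈ u m
      eqn    : ∀ (u : TSeries c n) k m →
               sumK (List.map (λ b → negPow b (f b (u (k ∸ b)) m)) (upTo (suc k)))
                 ≈ compose u F k m

  -- NSym: free associative K-algebra on Λ_1, Λ_2, ...; an element is a
  -- finite K-linear combination of words; letter i stands for Λ_{i+1}.

  NSym : Set a
  NSym = List (Carrier × List ℕ)

  nsCoeff : NSym → List ℕ → Carrier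
  nsCoeff []              w = 0#
  nsCoeff ((x , w') ∷ P) w with LP.≡-dec ℕ._≟_ w' w
  ... | yes _ = x + nsCoeff P w
  ... | no  _ = nsCoeff P w

  NonzeroNSym : NSym → Set ℓ
  NonzeroNSym P = ¬ (∀ w → nsCoeff P w ≈ 0#)

  -- S_{F_t} : Λ_m ↦ f_m, extended as a K-algebra homomorphism
  -- (a word Λ_{i1}⋯Λ_{ir} goes to the composite f_{i1} ∘ ⋯ ∘ f_{ir})
  opWord : ∀ {c n} → (ℕ → Series c n → Series c n) → List ℕ → Series c n → Series c n
  opWord f []      u = u
  opWord f (i ∷ w) u = f (suc i) (opWord f w u)

  𝒮 : ∀ {c n} → (ℕ → Series c n → Series c n) → NSym → Series c n → Series c n
  𝒮 f P u m = sumK (List.map (λ { (x , w) → x * opWord f w u m }) P)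

  IsZeroOp : ∀ {c n} → (Series c n → Series c n) → Set (a ⊔ ℓ)
  IsZeroOp φ = ∀ u m → φ u m ≈ 0#

module Submission where

-- Let M and L bound the letters and the lengths of the words of P. Take one variable y_s for each
-- vertex s of the rooted (M+1)-ary tree of depth L, plus one variable z₀, and let F = z - H with
-- H(y_s) = Σ_i t^{i+1} y_{child s i} z₀^e and H(z₀) = 0. Then H is homogeneous of degree e + 1,
-- JH is strictly triangular and F is invertible because H only moves away from the root. The
-- defining identity forces f_k(u) = (-1)^k [t^k] u(F), so f_{i+1} sends y_s z₀^e′ to
-- ± y_{child s i} z₀^{e+e′}. Hence the operator of a word w sends y_root to ± the monomial of the
-- vertex reached along w; distinct words reach distinct vertices, so the coefficient of that monomial
-- in S_F(P)(y_root) is ± the coefficient of w in P.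

open import Defs
open import Level using (Level; _⊔_)
open import Algebra.Bundles using (CommutativeRing; CommutativeMonoid)
import Algebra.Properties.CommutativeSemigroup as CommSemigroupProperties
open import Data.Nat as ℕ using (ℕ; zero; suc; _∸_; _≤_; _<_; s≤s; z≤n; _^_)
open import Data.Nat.DivMod using (_%_; [m+kn]%n≡m%n; m<n⇒m%n≡m)
import Data.Nat.Properties as NP
open import Data.Fin as Fin using (Fin; toℕ; fromℕ; fromℕ<)
import Data.Fin.Properties as FP
open import Data.Fin.Permutation as Permutation using (Permutation′; _⟨$⟩ʳ_)
open import Data.List as List
  using (List; []; _∷_; _++_; [_]; concat; concatMap; upTo; applyUpTo; allFin; foldr; map; replicate; tabulate; length)
import Data.List.Properties as LP
open import Data.List.Membership.Propositional using (_∈_; _∉_)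
open import Data.List.Membership.Propositional.Properties using (∈-++⁺ʳ; ∈-concatMap⁺; ∈-allFin)
open import Data.List.Relation.Unary.Any as Any using (here; there)
open import Data.List.Relation.Unary.All as All using (All; []; _∷_)
open import Data.List.Relation.Unary.All.Properties using (¬Any⇒All¬; ++⁻ˡ; ++⁻ʳ) renaming (++⁺ to All-++⁺)
open import Data.List.Relation.Binary.Pointwise as Pointwise using (Pointwise; []; _∷_)
open import Data.Vec as Vec using (Vec; []; _∷_; lookup; updateAt; zipWith)
import Data.Vec.Properties as VP
open import Data.Product using (Σ; ∃; ∃-syntax; _×_; _,_; proj₁; proj₂)
open import Data.Sum using (_⊎_; inj₁; inj₂)
open import Function using (_∘_; id)
open import Relation.Binary.PropositionalEquality as P using (_≡_; _≢_)
open import Relation.Nullary using (¬_; yes; no; Dec; contradiction)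
open import Relation.Nullary.Decidable using (_×-dec_)

module Monomials where

  ·M-assoc : ∀ {c n} (x y z : Mon c n) → (x ·M y) ·M z ≡ x ·M (y ·M z)
  ·M-assoc {comm}    = VP.zipWith-assoc NP.+-assoc
  ·M-assoc {noncomm} = LP.++-assoc

  ·M-identityˡ : ∀ {c n} (x : Mon c n) → oneMon ·M x ≡ x
  ·M-identityˡ {comm}    = VP.zipWith-identityˡ NP.+-identityˡ
  ·M-identityˡ {noncomm} x = P.refl

  ·M-identityʳ : ∀ {c n} (x : Mon c n) → x ·M oneMon ≡ x
  ·M-identityʳ {comm}    = VP.zipWith-identityʳ NP.+-identityʳ
  ·M-identityʳ {noncomm} = LP.++-identityʳ

  ·M-cancelʳ : ∀ {c n} (x y z : Mon c n) → x ·M z ≡ y ·M z → x ≡ y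
  ·M-cancelʳ {comm}    = +-cancelʳ
    where
    +-cancelʳ : ∀ {n} (x y z : Vec ℕ n) → zipWith ℕ._+_ x z ≡ zipWith ℕ._+_ y z → x ≡ y
    +-cancelʳ []       []       []       _  = P.refl
    +-cancelʳ (x ∷ xs) (y ∷ ys) (z ∷ zs) eq =
      P.cong₂ _∷_ (NP.+-cancelʳ-≡ z x y (VP.∷-injectiveˡ eq)) (+-cancelʳ xs ys zs (VP.∷-injectiveʳ eq))
  ·M-cancelʳ {noncomm} x y z = LP.++-cancelʳ z x y

  degree-·M : ∀ {c n} (x y : Mon c n) → degree (x ·M y) ≡ degree x ℕ.+ degree y
  degree-·M {comm}    = sum-zipWith
    where
    open CommSemigroupProperties NP.+-commutativeSemigroup using (interchange)
    sum-zipWith : ∀ {n} (x y : Vec ℕ n) → Vec.sum (zipWith ℕ._+_ x y) ≡ Vec.sum x ℕ.+ Vec.sum y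
    sum-zipWith []       []       = P.refl
    sum-zipWith (x ∷ xs) (y ∷ ys) = P.trans (P.cong (x ℕ.+ y ℕ.+_) (sum-zipWith xs ys)) (interchange x y _ _)
  degree-·M {noncomm} x y = LP.length-++ x

  degree-oneMon : ∀ {c n} → degree (oneMon {c} {n}) ≡ 0
  degree-oneMon {comm}    {n} = sum-zeros n
    where
    sum-zeros : ∀ n → Vec.sum (Vec.replicate n 0) ≡ 0
    sum-zeros zero    = P.refl
    sum-zeros (suc n) = sum-zeros n
  degree-oneMon {noncomm}     = P.refl

  degree-varMon : ∀ {c n} (i : Fin n) → degree (varMon {c} i) ≡ 1
  degree-varMon {comm}    {suc n} Fin.zero    = P.cong suc (degree-oneMon {comm} {n})
  degree-varMon {comm}    {suc n} (Fin.suc i) = degree-varMon {comm} i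
  degree-varMon {noncomm}         i           = P.refl

  -- Renaming the letters along g lets induction on v absorb the shift Fin.suc.
  renamedLetters : ∀ {n m} → Vec ℕ n → (Fin n → Fin m) → List (Fin m)
  renamedLetters v g = concat (tabulate (λ i → replicate (lookup v i) (g i)))

  letters-renamed : ∀ {n} (v : Vec ℕ n) → letters {comm} v ≡ renamedLetters v id
  letters-renamed v = P.cong concat (LP.map-tabulate id (λ i → replicate (lookup v i) i))

  map-renamedLetters : ∀ {n m k} (v : Vec ℕ n) (g : Fin n → Fin m) (h : Fin m → Fin k) →
    map h (renamedLetters v g) ≡ renamedLetters v (h ∘ g)
  map-renamedLetters []      g h = P.refl
  map-renamedLetters (x ∷ v) g h = begin
    map h (replicate x (g Fin.zero) ++ renamedLetters v (g ∘ Fin.suc))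
      ≡⟨ LP.map-++ h (replicate x _) _ ⟩
    map h (replicate x (g Fin.zero)) ++ map h (renamedLetters v (g ∘ Fin.suc))
      ≡⟨ P.cong₂ _++_ (LP.map-replicate h x _) (map-renamedLetters v (g ∘ Fin.suc) h) ⟩
    replicate x (h (g Fin.zero)) ++ renamedLetters v (h ∘ g ∘ Fin.suc) ∎
    where open P.≡-Reasoning

  renamedLetters-zeros : ∀ {n m} (g : Fin n → Fin m) → renamedLetters (Vec.replicate n 0) g ≡ []
  renamedLetters-zeros {zero}  g = P.refl
  renamedLetters-zeros {suc n} g = renamedLetters-zeros (g ∘ Fin.suc)

  renamedLetters-unit : ∀ {n m} (i : Fin n) (g : Fin n → Fin m) →
    renamedLetters (updateAt (Vec.replicate n 0) i suc) g ≡ [ g i ]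
  renamedLetters-unit {suc n} Fin.zero    g = P.cong (g Fin.zero ∷_) (renamedLetters-zeros (g ∘ Fin.suc))
  renamedLetters-unit {suc n} (Fin.suc i) g = renamedLetters-unit i (g ∘ Fin.suc)

  letters-varMon : ∀ {c n} (i : Fin n) → letters (varMon {c} i) ≡ [ i ]
  letters-varMon {comm}    {n} i = P.trans (letters-renamed (varMon {comm} i)) (renamedLetters-unit i id)
  letters-varMon {noncomm}     i = P.refl

  prodMon : ∀ {c n} → List (Fin n) → Mon c n
  prodMon = foldr (λ i m → varMon i ·M m) oneMon

  prodMon-++ : ∀ {c n} (xs ys : List (Fin n)) → prodMon {c} (xs ++ ys) ≡ prodMon xs ·M prodMon ys
  prodMon-++ []       ys = P.sym (·M-identityˡ _)
  prodMon-++ (x ∷ xs) ys = P.trans (P.cong (varMon x ·M_) (prodMon-++ xs ys)) (P.sym (·M-assoc (varMon x) _ _))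

  prodMon-letters : ∀ {c n} (v : Mon c n) → prodMon (letters v) ≡ v
  prodMon-letters {comm}    v       = P.trans (P.cong prodMon (letters-renamed v)) (prodMon-renamed v)
    where
    prodMon-replicate-zero : ∀ {n} x → prodMon {comm} {suc n} (replicate x Fin.zero) ≡ x ∷ Vec.replicate n 0
    prodMon-replicate-zero {n} zero    = P.refl
    prodMon-replicate-zero {n} (suc x) rewrite prodMon-replicate-zero {n} x = P.cong (suc x ∷_) (·M-identityˡ {comm} _)
    prodMon-map-suc : ∀ {n} (ls : List (Fin n)) → prodMon {comm} (map Fin.suc ls) ≡ 0 ∷ prodMon ls
    prodMon-map-suc []       = P.refl
    prodMon-map-suc (l ∷ ls) = P.cong (zipWith ℕ._+_ (varMon {comm} (Fin.suc l))) (prodMon-map-suc ls)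
    prodMon-renamed : ∀ {n} (v : Vec ℕ n) → prodMon {comm} (renamedLetters v id) ≡ v
    prodMon-renamed []          = P.refl
    prodMon-renamed {suc n} (x ∷ v) = begin
      prodMon (replicate x Fin.zero ++ renamedLetters v Fin.suc)
        ≡⟨ prodMon-++ (replicate x Fin.zero) _ ⟩
      prodMon (replicate x Fin.zero) ·M prodMon (renamedLetters v Fin.suc)
        ≡⟨ P.cong₂ _·M_ (prodMon-replicate-zero x)
             (P.trans (P.cong prodMon (P.sym (map-renamedLetters v id Fin.suc))) (prodMon-map-suc (renamedLetters v id))) ⟩
      (x ∷ Vec.replicate n 0) ·M (0 ∷ prodMon (renamedLetters v id))
        ≡⟨ P.cong₂ _∷_ (NP.+-identityʳ x) (P.trans (·M-identityˡ {comm} _) (prodMon-renamed v)) ⟩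
      x ∷ v ∎
      where open P.≡-Reasoning
  prodMon-letters {noncomm} []      = P.refl
  prodMon-letters {noncomm} (x ∷ v) = P.cong (x ∷_) (prodMon-letters v)

  ∈-letters-updateAt : ∀ {n} (m : Vec ℕ n) j → j ∈ letters {comm} (updateAt m j suc)
  ∈-letters-updateAt m j = ∈-concatMap⁺ _ (Any.map j∈ (∈-allFin j))
    where
    j∈ : ∀ {i} → j ≡ i → j ∈ replicate (lookup (updateAt m j suc) i) i
    j∈ P.refl = P.subst (λ k → j ∈ replicate k j) (P.sym (VP.lookup∘updateAt j m)) (here P.refl)

  z₀ : ∀ {S} → Fin (suc S)
  z₀ {S} = fromℕ S

  infix 30 z₀^_
  z₀^_ : ∀ {c S} → ℕ → Mon c (suc S)
  z₀^ zero  = oneMon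
  z₀^ suc e = varMon z₀ ·M z₀^ e

  z₀^-+ : ∀ {c S} e e′ → (z₀^ e) ·M (z₀^ e′) ≡ z₀^_ {c} {S} (e ℕ.+ e′)
  z₀^-+ zero    e′ = ·M-identityˡ _
  z₀^-+ (suc e) e′ = P.trans (·M-assoc (varMon z₀) (z₀^ e) (z₀^ e′)) (P.cong (varMon z₀ ·M_) (z₀^-+ e e′))

  degree-z₀^ : ∀ {c S} e → degree (z₀^_ {c} {S} e) ≡ e
  degree-z₀^ {c} {S} zero    = degree-oneMon {c} {suc S}
  degree-z₀^ {c} {S} (suc e) =
    P.trans (degree-·M {c} (varMon z₀) (z₀^ e)) (P.cong₂ ℕ._+_ (degree-varMon {c} (z₀ {S})) (degree-z₀^ {c} {S} e))

  -- z₀ is the last variable, so in the commutative case too the letters of z₀^e come last.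
  letters-·z₀^ : ∀ {c S} (m : Mon c (suc S)) e → letters (m ·M z₀^ e) ≡ letters m ++ replicate e z₀
  letters-·z₀^ {comm} {S} m e =
    P.trans (letters-renamed (m ·M z₀^ e))
      (P.trans (renamed-·z₀^ m id e) (P.cong (_++ replicate e z₀) (P.sym (letters-renamed m))))
    where
    replicate-+ : ∀ {A : Set} x e (y : A) → replicate (x ℕ.+ e) y ≡ replicate x y ++ replicate e y
    replicate-+ zero    e y = P.refl
    replicate-+ (suc x) e y = P.cong (y ∷_) (replicate-+ x e y)
    z₀^-last : ∀ e → z₀^_ {comm} {0} e ≡ e ∷ []
    z₀^-last zero    = P.refl
    z₀^-last (suc e) rewrite z₀^-last e = P.refl
    z₀^-suc : ∀ {S} e → z₀^_ {comm} {suc S} e ≡ 0 ∷ z₀^ e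
    z₀^-suc zero        = P.refl
    z₀^-suc {S} (suc e) rewrite z₀^-suc {S} e = P.refl
    renamed-·z₀^ : ∀ {S m} (v : Vec ℕ (suc S)) (g : Fin (suc S) → Fin m) e →
      renamedLetters (v ·M z₀^ e) g ≡ renamedLetters v g ++ replicate e (g z₀)
    renamed-·z₀^ {zero}  (x ∷ []) g e rewrite z₀^-last e =
      P.trans (LP.++-identityʳ _)
        (P.trans (replicate-+ x e _) (P.cong (_++ replicate e (g Fin.zero)) (P.sym (LP.++-identityʳ _))))
    renamed-·z₀^ {suc S} (x ∷ v) g e rewrite z₀^-suc {S} e | NP.+-identityʳ x =
      P.trans (P.cong (replicate x (g Fin.zero) ++_) (renamed-·z₀^ v (g ∘ Fin.suc) e))
        (P.sym (LP.++-assoc (replicate x (g Fin.zero)) _ _))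
  letters-·z₀^ {noncomm} m e = P.cong (m ++_) (replicate-z₀ e)
    where
    replicate-z₀ : ∀ {S} e → z₀^_ {noncomm} {S} e ≡ replicate e z₀
    replicate-z₀ zero    = P.refl
    replicate-z₀ (suc e) = P.cong (z₀ ∷_) (replicate-z₀ e)

module TreeVertices (MM : ℕ) where

  Base : ℕ
  Base = suc MM

  child : ℕ → ℕ → ℕ
  child s i = s ℕ.* Base ℕ.+ suc i

  s<child : ∀ s i → s < child s i
  s<child s i = NP.≤-trans (s≤s (NP.≤-trans (NP.m≤m*n s Base) (NP.m≤m+n (s ℕ.* Base) i)))
                           (NP.≤-reflexive (P.sym (NP.+-suc (s ℕ.* Base) i)))

  vertex : List ℕ → ℕ
  vertex []      = 0
  vertex (i ∷ w) = child (vertex w) i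

  vertex-bound : ∀ w → All (_< MM) w → vertex w < Base ^ length w
  vertex-bound []      []            = s≤s z≤n
  vertex-bound (i ∷ w) (i<MM ∷ w<MM) = begin-strict
    vertex w ℕ.* Base ℕ.+ suc i ≤⟨ NP.+-monoʳ-≤ (vertex w ℕ.* Base) i<MM ⟩
    vertex w ℕ.* Base ℕ.+ MM    <⟨ NP.+-monoʳ-< (vertex w ℕ.* Base) (NP.n<1+n MM) ⟩
    vertex w ℕ.* Base ℕ.+ Base  ≡⟨ NP.+-comm (vertex w ℕ.* Base) Base ⟩
    suc (vertex w) ℕ.* Base      ≤⟨ NP.*-monoˡ-≤ Base (vertex-bound w w<MM) ⟩
    Base ^ length w ℕ.* Base     ≡⟨ NP.*-comm (Base ^ length w) Base ⟩
    Base ^ length (i ∷ w)        ∎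
    where open NP.≤-Reasoning

  -- vertex w is w read as a numeral in base Base with digits i + 1.
  vertex-injective : ∀ {w w′} → All (_< MM) w → All (_< MM) w′ → vertex w ≡ vertex w′ → w ≡ w′
  vertex-injective {[]}    {[]}     _              _                _  = P.refl
  vertex-injective {[]}    {i ∷ w′} _              _                eq = contradiction (P.trans eq (NP.+-suc _ i)) (λ ())
  vertex-injective {i ∷ w} {[]}     _              _                eq = contradiction (P.trans (P.sym eq) (NP.+-suc _ i)) (λ ())
  vertex-injective {i ∷ w} {i′ ∷ w′} (i<MM ∷ w<MM) (i′<MM ∷ w′<MM) eq =
    P.cong₂ _∷_ i≡i′ (vertex-injective w<MM w′<MM w≡w′)
    where
    last-digit : ∀ x r → r < Base → (x ℕ.* Base ℕ.+ r) % Base ≡ r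
    last-digit x r r< = P.trans (P.cong (_% Base) (NP.+-comm (x ℕ.* Base) r)) (P.trans ([m+kn]%n≡m%n r x Base) (m<n⇒m%n≡m r<))
    i≡i′ : i ≡ i′
    i≡i′ = NP.suc-injective (P.trans (P.sym (last-digit (vertex w) (suc i) (s≤s i<MM)))
                                     (P.trans (P.cong (_% Base) eq) (last-digit (vertex w′) (suc i′) (s≤s i′<MM))))
    w≡w′ : vertex w ≡ vertex w′
    w≡w′ = NP.*-cancelʳ-≡ (vertex w) (vertex w′) Base
             (NP.+-cancelʳ-≡ (suc i) _ _ (P.trans eq (P.cong (λ j → vertex w′ ℕ.* Base ℕ.+ suc j) (P.sym i≡i′))))

module _ {a ℓ} (K : CommutativeRing a ℓ) where
  open CommutativeRing K hiding (zero)
  open Over K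
  open Term
  open Monomials
  open import Algebra.Properties.Ring ring using (-0#≈0#; -‿+-comm; -‿distribˡ-*; -‿distribʳ-*; -‿involutive)
  open CommSemigroupProperties (CommutativeMonoid.commutativeSemigroup +-commutativeMonoid) using (interchange)
  open import Relation.Binary.Reasoning.Setoid setoid

  -- Signs and finite sums

  negPow-cong : ∀ b {x y} → x ≈ y → negPow b x ≈ negPow b y
  negPow-cong zero    e = e
  negPow-cong (suc b) e = -‿cong (negPow-cong b e)

  negPow-+ : ∀ b x y → negPow b (x + y) ≈ negPow b x + negPow b y
  negPow-+ zero    x y = refl
  negPow-+ (suc b) x y = trans (-‿cong (negPow-+ b x y)) (sym (-‿+-comm _ _))

  negPow-* : ∀ b x y → negPow b (x * y) ≈ x * negPow b y
  negPow-* zero    x y = refl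
  negPow-* (suc b) x y = trans (-‿cong (negPow-* b x y)) (-‿distribʳ-* _ _)

  negPow-0# : ∀ b → negPow b 0# ≈ 0#
  negPow-0# zero    = refl
  negPow-0# (suc b) = trans (-‿cong (negPow-0# b)) -0#≈0#

  negPow-‿ : ∀ b x → negPow b (- x) ≈ - negPow b x
  negPow-‿ zero    x = refl
  negPow-‿ (suc b) x = -‿cong (negPow-‿ b x)

  negPow-+ℕ : ∀ b b′ x → negPow b (negPow b′ x) ≡ negPow (b ℕ.+ b′) x
  negPow-+ℕ zero    b′ x = P.refl
  negPow-+ℕ (suc b) b′ x = P.cong -_ (negPow-+ℕ b b′ x)

  negPow-involutive : ∀ b x → negPow b (negPow b x) ≈ x
  negPow-involutive zero    x = refl
  negPow-involutive (suc b) x = begin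
    - negPow b (- negPow b x) ≈⟨ -‿cong (negPow-‿ b _) ⟩
    - - negPow b (negPow b x) ≈⟨ -‿involutive _ ⟩
    negPow b (negPow b x)     ≈⟨ negPow-involutive b x ⟩
    x                         ∎

  negPow≈0⇒≈0 : ∀ b x → negPow b x ≈ 0# → x ≈ 0#
  negPow≈0⇒≈0 b x e = trans (sym (negPow-involutive b x)) (trans (negPow-cong b e) (negPow-0# b))

  x+y-y≈x : ∀ x y → (x + y) + - y ≈ x
  x+y-y≈x x y = trans (+-assoc x y (- y)) (trans (+-congˡ (-‿inverseʳ y)) (+-identityʳ x))

  x-y+y≈x : ∀ x y → (x + - y) + y ≈ x
  x-y+y≈x x y = trans (+-assoc x (- y) y) (trans (+-congˡ (-‿inverseˡ y)) (+-identityʳ x))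

  sumMap : ∀ {b} {A : Set b} → (A → Carrier) → List A → Carrier
  sumMap g xs = sumK (map g xs)

  sumK-++ : ∀ xs ys → sumK (xs ++ ys) ≈ sumK xs + sumK ys
  sumK-++ []       ys = sym (+-identityˡ _)
  sumK-++ (x ∷ xs) ys = trans (+-congˡ (sumK-++ xs ys)) (sym (+-assoc _ _ _))

  sumMap-++ : ∀ {b} {A : Set b} (g : A → Carrier) xs ys → sumMap g (xs ++ ys) ≈ sumMap g xs + sumMap g ys
  sumMap-++ g xs ys = trans (reflexive (P.cong sumK (LP.map-++ g xs ys))) (sumK-++ (map g xs) (map g ys))

  sumMap-cong : ∀ {b} {A : Set b} {g h : A → Carrier} xs → (∀ x → g x ≈ h x) → sumMap g xs ≈ sumMap h xs
  sumMap-cong []       e = refl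
  sumMap-cong (x ∷ xs) e = +-cong (e x) (sumMap-cong xs e)

  sumMap-zero : ∀ {b} {A : Set b} {g : A → Carrier} xs → (∀ x → g x ≈ 0#) → sumMap g xs ≈ 0#
  sumMap-zero []       e = refl
  sumMap-zero (x ∷ xs) e = trans (+-cong (e x) (sumMap-zero xs e)) (+-identityˡ 0#)

  sumMap-+ : ∀ {b} {A : Set b} (g h : A → Carrier) xs → sumMap (λ x → g x + h x) xs ≈ sumMap g xs + sumMap h xs
  sumMap-+ g h []       = sym (+-identityˡ 0#)
  sumMap-+ g h (x ∷ xs) = trans (+-congˡ (sumMap-+ g h xs)) (interchange _ _ _ _)

  sumMap-*ˡ : ∀ {b} {A : Set b} (x : Carrier) (g : A → Carrier) xs → sumMap (λ y → x * g y) xs ≈ x * sumMap g xs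
  sumMap-*ˡ x g []       = sym (zeroʳ x)
  sumMap-*ˡ x g (y ∷ xs) = trans (+-congˡ (sumMap-*ˡ x g xs)) (sym (distribˡ x _ _))

  sumMap-map : ∀ {b c} {A : Set b} {B : Set c} (g : B → Carrier) (f : A → B) xs → sumMap g (map f xs) ≈ sumMap (g ∘ f) xs
  sumMap-map g f xs = reflexive (P.cong sumK (P.sym (LP.map-∘ xs)))

  sumMap-concatMap : ∀ {b c} {A : Set b} {B : Set c} (g : B → Carrier) (f : A → List B) xs →
    sumMap g (concatMap f xs) ≈ sumMap (λ x → sumMap g (f x)) xs
  sumMap-concatMap g f []       = refl
  sumMap-concatMap g f (x ∷ xs) = trans (sumMap-++ g (f x) (concatMap f xs)) (+-congˡ (sumMap-concatMap g f xs))

  sumK-applyUpTo-cong : ∀ N {g h : ℕ → Carrier} → (∀ b → b < N → g b ≈ h b) →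
    sumK (applyUpTo g N) ≈ sumK (applyUpTo h N)
  sumK-applyUpTo-cong zero    e = refl
  sumK-applyUpTo-cong (suc N) e = +-cong (e 0 (s≤s z≤n)) (sumK-applyUpTo-cong N (λ b b< → e (suc b) (s≤s b<)))

  sumK-applyUpTo-zero : ∀ N (h : ℕ → Carrier) → (∀ b → b < N → h b ≈ 0#) → sumK (applyUpTo h N) ≈ 0#
  sumK-applyUpTo-zero zero    h z = refl
  sumK-applyUpTo-zero (suc N) h z =
    trans (+-cong (z 0 (s≤s z≤n)) (sumK-applyUpTo-zero N (h ∘ suc) (λ b b< → z (suc b) (s≤s b<)))) (+-identityˡ 0#)

  sumK-applyUpTo-δ : ∀ N (h : ℕ → Carrier) b₀ → b₀ < N → (∀ b → b < N → b ≢ b₀ → h b ≈ 0#) →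
    sumK (applyUpTo h N) ≈ h b₀
  sumK-applyUpTo-δ (suc N) h zero     _         z =
    trans (+-congˡ (sumK-applyUpTo-zero N (h ∘ suc) (λ b b< → z (suc b) (s≤s b<) (λ ())))) (+-identityʳ _)
  sumK-applyUpTo-δ (suc N) h (suc b₀) (s≤s b₀<) z =
    trans (+-cong (z 0 (s≤s z≤n) (λ ())) (sumK-applyUpTo-δ N (h ∘ suc) b₀ b₀<
                                           (λ b b< ne → z (suc b) (s≤s b<) (ne ∘ NP.suc-injective))))
          (+-identityˡ _)

  sumMap-upTo-zero : ∀ N (g : ℕ → Carrier) → (∀ b → b < N → g b ≈ 0#) → sumMap g (upTo N) ≈ 0#
  sumMap-upTo-zero N g z = trans (reflexive (P.cong sumK (LP.map-upTo g N))) (sumK-applyUpTo-zero N g z)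

  sumMap-upTo-δ : ∀ N (g : ℕ → Carrier) b₀ → b₀ < N → (∀ b → b < N → b ≢ b₀ → g b ≈ 0#) →
    sumMap g (upTo N) ≈ g b₀
  sumMap-upTo-δ N g b₀ b₀< z = trans (reflexive (P.cong sumK (LP.map-upTo g N))) (sumK-applyUpTo-δ N g b₀ b₀< z)

  sumMap-upTo-reverse : ∀ k (H : ℕ → ℕ → Carrier) →
    sumMap (λ b → H (k ∸ b) b) (upTo (suc k)) ≈ sumMap (λ b → H b (k ∸ b)) (upTo (suc k))
  sumMap-upTo-reverse k H = begin
    sumMap (λ b → H (k ∸ b) b) (upTo (suc k))
      ≡⟨ P.cong sumK (LP.map-upTo _ (suc k)) ⟩
    sumK (applyUpTo (λ b → H (k ∸ b) b) (suc k))
      ≈⟨ sumK-applyUpTo-cong (suc k) (λ b b< → reflexive (P.cong (H (k ∸ b)) (P.sym (NP.m∸[m∸n]≡n (NP.≤-pred b<))))) ⟩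
    sumK (applyUpTo (λ b → H (k ∸ b) (k ∸ (k ∸ b))) (suc k))
      ≈⟨ reverse k (λ b → H b (k ∸ b)) ⟩
    sumK (applyUpTo (λ b → H b (k ∸ b)) (suc k))
      ≡⟨ P.cong sumK (P.sym (LP.map-upTo _ (suc k))) ⟩
    sumMap (λ b → H b (k ∸ b)) (upTo (suc k)) ∎
    where
    snoc : ∀ N (g : ℕ → Carrier) → sumK (applyUpTo g (suc N)) ≈ sumK (applyUpTo g N) + g N
    snoc N g = trans (reflexive (P.cong sumK (P.sym (LP.applyUpTo-∷ʳ g N))))
                 (trans (sumK-++ (applyUpTo g N) (g N ∷ [])) (+-congˡ (+-identityʳ _)))
    reverse : ∀ N (g : ℕ → Carrier) → sumK (applyUpTo (λ b → g (N ∸ b)) (suc N)) ≈ sumK (applyUpTo g (suc N))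
    reverse zero    g = refl
    reverse (suc N) g = trans (+-congˡ (reverse N g)) (trans (+-comm _ _) (sym (snoc (suc N) g)))

  sumMap-allFin-δ : ∀ n (g : Fin n → Carrier) i₀ → (∀ i → i ≢ i₀ → g i ≈ 0#) → sumMap g (allFin n) ≈ g i₀
  sumMap-allFin-δ n g i₀ z = trans (reflexive (P.cong sumK (LP.map-tabulate id g))) (sumK-tabulate-δ g i₀ z)
    where
    sumK-tabulate-zero : ∀ {n} (h : Fin n → Carrier) → (∀ i → h i ≈ 0#) → sumK (tabulate h) ≈ 0#
    sumK-tabulate-zero {zero}  h z = refl
    sumK-tabulate-zero {suc n} h z = trans (+-cong (z Fin.zero) (sumK-tabulate-zero (h ∘ Fin.suc) (z ∘ Fin.suc))) (+-identityˡ 0#)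
    sumK-tabulate-δ : ∀ {n} (h : Fin n → Carrier) i₀ → (∀ i → i ≢ i₀ → h i ≈ 0#) → sumK (tabulate h) ≈ h i₀
    sumK-tabulate-δ {suc n} h Fin.zero     z =
      trans (+-congˡ (sumK-tabulate-zero (h ∘ Fin.suc) (λ i → z (Fin.suc i) (λ ())))) (+-identityʳ _)
    sumK-tabulate-δ {suc n} h (Fin.suc i₀) z =
      trans (+-cong (z Fin.zero (λ ())) (sumK-tabulate-δ (h ∘ Fin.suc) i₀ (λ i ne → z (Fin.suc i) (ne ∘ FP.suc-injective))))
            (+-identityˡ _)

  -- Coefficients, products and substitution

  module _ {c : Case} {n : ℕ} where

    termCoeff : Term c n → ℕ → Mon c n → Carrier
    termCoeff (term x j m′) k m with j ℕ.≟ k | m′ ≟M m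
    ... | yes _ | yes _ = x
    ... | _     | _     = 0#

    coeff-sumMap : ∀ (p : Poly c n) k m → coeff p k m ≈ sumMap (λ τ → termCoeff τ k m) p
    coeff-sumMap []                k m = refl
    coeff-sumMap (term x j m′ ∷ p) k m with j ℕ.≟ k | m′ ≟M m
    ... | yes _ | yes _ = +-congˡ (coeff-sumMap p k m)
    ... | yes _ | no _  = trans (coeff-sumMap p k m) (sym (+-identityˡ _))
    ... | no _  | _     = trans (coeff-sumMap p k m) (sym (+-identityˡ _))

    coeff-++ : ∀ (p q : Poly c n) k m → coeff (p ++ q) k m ≈ coeff p k m + coeff q k m
    coeff-++ p q k m = begin
      coeff (p ++ q) k m                                ≈⟨ coeff-sumMap (p ++ q) k m ⟩
      sumMap (λ τ → termCoeff τ k m) (p ++ q)           ≈⟨ sumMap-++ (λ τ → termCoeff τ k m) p q ⟩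
      sumMap (λ τ → termCoeff τ k m) p + sumMap (λ τ → termCoeff τ k m) q
                                                        ≈⟨ +-cong (sym (coeff-sumMap p k m)) (sym (coeff-sumMap q k m)) ⟩
      coeff p k m + coeff q k m                         ∎

    coeff-concatMap : ∀ {b} {A : Set b} (f : A → Poly c n) xs k m →
      coeff (concatMap f xs) k m ≈ sumMap (λ x → coeff (f x) k m) xs
    coeff-concatMap f xs k m = begin
      coeff (concatMap f xs) k m                                 ≈⟨ coeff-sumMap (concatMap f xs) k m ⟩
      sumMap (λ τ → termCoeff τ k m) (concatMap f xs)            ≈⟨ sumMap-concatMap (λ τ → termCoeff τ k m) f xs ⟩
      sumMap (λ x → sumMap (λ τ → termCoeff τ k m) (f x)) xs     ≈⟨ sumMap-cong xs (λ x → sym (coeff-sumMap (f x) k m)) ⟩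
      sumMap (λ x → coeff (f x) k m) xs                          ∎

    coeff-negP : ∀ (p : Poly c n) k m → coeff (negP p) k m ≈ - coeff p k m
    coeff-negP []                k m = sym -0#≈0#
    coeff-negP (term x j m′ ∷ p) k m with j ℕ.≟ k | m′ ≟M m
    ... | yes _ | yes _ = trans (+-congˡ (coeff-negP p k m)) (-‿+-comm _ _)
    ... | yes _ | no _  = coeff-negP p k m
    ... | no _  | _     = coeff-negP p k m

    coeff-absent : ∀ (p : Poly c n) k m → All (λ τ → tpow τ ≢ k ⊎ mon τ ≢ m) p → coeff p k m ≈ 0#
    coeff-absent []                k m []       = refl
    coeff-absent (term x j m′ ∷ p) k m (h ∷ hs) with j ℕ.≟ k | m′ ≟M m | h
    ... | yes j≡k | yes _    | inj₁ j≢k = contradiction j≡k j≢k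
    ... | yes _   | yes m′≡m | inj₂ m′≢m = contradiction m′≡m m′≢m
    ... | yes _   | no _     | _ = coeff-absent p k m hs
    ... | no _    | _        | _ = coeff-absent p k m hs

    δ : Mon c n → Series c n
    δ μ m with μ ≟M m
    ... | yes _ = 1#
    ... | no _  = 0#

    δ-diag : ∀ μ → δ μ μ ≈ 1#
    δ-diag μ with μ ≟M μ
    ... | yes _ = refl
    ... | no μ≢μ = contradiction P.refl μ≢μ

    δ-off : ∀ μ m → μ ≢ m → δ μ m ≈ 0#
    δ-off μ m μ≢m with μ ≟M m
    ... | yes μ≡m = contradiction μ≡m μ≢m
    ... | no _    = refl

    coeff-monomial : ∀ k (μ m : Mon c n) → coeff (term 1# k μ ∷ []) k m ≈ δ μ m
    coeff-monomial k μ m with k ℕ.≟ k | μ ≟M m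
    ... | yes _ | yes _ = +-identityʳ _
    ... | yes _ | no _  = refl
    ... | no k≢k | _    = contradiction P.refl k≢k

    infix 4 _≈ᵗ_ _≋_

    _≈ᵗ_ : Term c n → Term c n → Set ℓ
    τ ≈ᵗ σ = coef τ ≈ coef σ × tpow τ ≡ tpow σ × mon τ ≡ mon σ

    _≋_ : Poly c n → Poly c n → Set (a ⊔ ℓ)
    _≋_ = Pointwise _≈ᵗ_

    ≋-refl : ∀ {p} → p ≋ p
    ≋-refl = Pointwise.refl (refl , P.refl , P.refl)

    ≋-reflexive : ∀ {p q} → p ≡ q → p ≋ q
    ≋-reflexive P.refl = ≋-refl

    ≋-sym : ∀ {p q} → p ≋ q → q ≋ p
    ≋-sym = Pointwise.symmetric (λ (e , f , g) → sym e , P.sym f , P.sym g)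

    ≋-trans : ∀ {p q r} → p ≋ q → q ≋ r → p ≋ r
    ≋-trans = Pointwise.transitive (λ (e , f , g) (e′ , f′ , g′) → trans e e′ , P.trans f f′ , P.trans g g′)

    coeff-≋ : ∀ {p q} → p ≋ q → ∀ k m → coeff p k m ≈ coeff q k m
    coeff-≋ []                                                      k m = refl
    coeff-≋ {term x j m′ ∷ p} {term y .j .m′ ∷ q} ((e , P.refl , P.refl) ∷ es) k m with j ℕ.≟ k | m′ ≟M m
    ... | yes _ | yes _ = +-cong e (coeff-≋ es k m)
    ... | yes _ | no _  = coeff-≋ es k m
    ... | no _  | _     = coeff-≋ es k m

    ≋-map : ∀ (f g : Term c n → Term c n) (p : Poly c n) → (∀ τ → f τ ≈ᵗ g τ) → map f p ≋ map g p
    ≋-map f g []      e = []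
    ≋-map f g (τ ∷ p) e = e τ ∷ ≋-map f g p e

    ≋-map-cong : ∀ (f : Term c n → Term c n) → (∀ {τ σ} → τ ≈ᵗ σ → f τ ≈ᵗ f σ) →
      ∀ {p q} → p ≋ q → map f p ≋ map f q
    ≋-map-cong f f-cong []       = []
    ≋-map-cong f f-cong (e ∷ es) = f-cong e ∷ ≋-map-cong f f-cong es

    ≋-concatMap : ∀ {b} {A : Set b} (f g : A → Poly c n) xs → (∀ x → f x ≋ g x) → concatMap f xs ≋ concatMap g xs
    ≋-concatMap f g []       e = []
    ≋-concatMap f g (x ∷ xs) e = Pointwise.++⁺ (e x) (≋-concatMap f g xs e)

    ≐P-concatMap : ∀ {b} {A : Set b} (f g : A → Poly c n) xs → (∀ x → f x ≐P g x) → concatMap f xs ≐P concatMap g xs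
    ≐P-concatMap f g xs e k m =
      trans (coeff-concatMap f xs k m) (trans (sumMap-cong xs (λ x → e x k m)) (sym (coeff-concatMap g xs k m)))

    -- By injectivity, each coefficient of a relabelled polynomial is x times a single coefficient of the original.
    module _ (x : Carrier) {φ : ℕ → ℕ} {h : Mon c n → Mon c n}
             (φ-inj : ∀ {i j} → φ i ≡ φ j → i ≡ j) (h-inj : ∀ {u v} → h u ≡ h v → u ≡ v) where

      relabel : Term c n → Term c n
      relabel τ = term (x * coef τ) (φ (tpow τ)) (h (mon τ))

      private
        Hits : ℕ → Mon c n → Term c n → Set
        Hits k m τ = φ (tpow τ) ≡ k × h (mon τ) ≡ m

        termCoeff-hit : ∀ {l₀ m₀ k m} → φ l₀ ≡ k → h m₀ ≡ m →
          ∀ τ → termCoeff (relabel τ) k m ≈ x * termCoeff τ l₀ m₀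
        termCoeff-hit {l₀} {m₀} {k} {m} e f (term y j m′) with φ j ℕ.≟ k | h m′ ≟M m | j ℕ.≟ l₀ | m′ ≟M m₀
        ... | yes _  | yes _  | yes _  | yes _  = refl
        ... | yes e₁ | yes _  | no ne  | _      = contradiction (φ-inj (P.trans e₁ (P.sym e))) ne
        ... | yes _  | yes e₂ | yes _  | no ne  = contradiction (h-inj (P.trans e₂ (P.sym f))) ne
        ... | yes _  | no ne  | yes _  | yes e₃ = contradiction (P.trans (P.cong h e₃) f) ne
        ... | yes _  | no _   | yes _  | no _   = sym (zeroʳ x)
        ... | yes _  | no _   | no _   | _      = sym (zeroʳ x)
        ... | no ne  | _      | yes e₃ | _      = contradiction (P.trans (P.cong φ e₃) e) ne
        ... | no _   | _      | no _   | _      = sym (zeroʳ x)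

        coeff-hit : ∀ p {l₀ m₀ k m} → φ l₀ ≡ k → h m₀ ≡ m → coeff (map relabel p) k m ≈ x * coeff p l₀ m₀
        coeff-hit p {l₀} {m₀} {k} {m} e f = begin
          coeff (map relabel p) k m                          ≈⟨ coeff-sumMap (map relabel p) k m ⟩
          sumMap (λ τ → termCoeff τ k m) (map relabel p)     ≈⟨ sumMap-map (λ τ → termCoeff τ k m) relabel p ⟩
          sumMap (λ τ → termCoeff (relabel τ) k m) p         ≈⟨ sumMap-cong p (termCoeff-hit e f) ⟩
          sumMap (λ τ → x * termCoeff τ l₀ m₀) p             ≈⟨ sumMap-*ˡ x _ p ⟩
          x * sumMap (λ τ → termCoeff τ l₀ m₀) p             ≈⟨ *-congˡ (sym (coeff-sumMap p l₀ m₀)) ⟩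
          x * coeff p l₀ m₀                                  ∎

        coeff-miss : ∀ p k m → All (¬_ ∘ Hits k m) p → coeff (map relabel p) k m ≈ 0#
        coeff-miss []      k m []       = refl
        coeff-miss (τ ∷ p) k m (h₀ ∷ hs) with φ (tpow τ) ℕ.≟ k | h (mon τ) ≟M m
        ... | yes e₁ | yes e₂ = contradiction (e₁ , e₂) h₀
        ... | yes _  | no _   = coeff-miss p k m hs
        ... | no _   | _      = coeff-miss p k m hs

      ≐P-relabel : ∀ {p q} → p ≐P q → map relabel p ≐P map relabel q
      ≐P-relabel {p} {q} e k m with Any.any? (λ τ → (φ (tpow τ) ℕ.≟ k) ×-dec (h (mon τ) ≟M m)) (p ++ q)
      ... | yes hit = let (τ , e₁ , e₂) = Any.satisfied hit in
        trans (coeff-hit p e₁ e₂) (trans (*-congˡ (e (tpow τ) (mon τ))) (sym (coeff-hit q e₁ e₂)))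
      ... | no miss = let none = ¬Any⇒All¬ (p ++ q) miss in
        trans (coeff-miss p k m (++⁻ˡ p none)) (sym (coeff-miss q k m (++⁻ʳ p none)))

    lmulTerm : Term c n → Term c n → Term c n
    lmulTerm σ τ = term (coef σ * coef τ) (tpow σ ℕ.+ tpow τ) (mon σ ·M mon τ)

    lmulTerm-congʳ : ∀ ρ {τ σ} → τ ≈ᵗ σ → lmulTerm ρ τ ≈ᵗ lmulTerm ρ σ
    lmulTerm-congʳ ρ (e₁ , e₂ , e₃) = *-congˡ e₁ , P.cong (tpow ρ ℕ.+_) e₂ , P.cong (mon ρ ·M_) e₃

    *P-∷ : ∀ σ (p q : Poly c n) → (σ ∷ p) *P q ≡ map (lmulTerm σ) q ++ (p *P q)
    *P-∷ (term x k m) p q = P.refl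

    *P-congʳ : ∀ (p : Poly c n) {q q′} → q ≋ q′ → p *P q ≋ p *P q′
    *P-congʳ []      e = []
    *P-congʳ (σ ∷ p) {q} {q′} e = ≋-trans (≋-reflexive (*P-∷ σ p q)) (≋-trans
      (Pointwise.++⁺ (≋-map-cong (lmulTerm σ) (lmulTerm-congʳ σ) e)
                     (*P-congʳ p e))
      (≋-reflexive (P.sym (*P-∷ σ p q′))))

    *P-oneP : ∀ (p : Poly c n) → p *P oneP ≋ p
    *P-oneP []      = []
    *P-oneP (σ ∷ p) = ≋-trans (≋-reflexive (*P-∷ σ p oneP))
      ((*-identityʳ _ , NP.+-identityʳ _ , ·M-identityʳ (mon σ)) ∷ *P-oneP p)

    rmulMon : Mon c n → Term c n → Term c n
    rmulMon μ τ = term (coef τ) (tpow τ) (mon τ ·M μ)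

    rmulMon-cong : ∀ μ {τ σ} → τ ≈ᵗ σ → rmulMon μ τ ≈ᵗ rmulMon μ σ
    rmulMon-cong μ (e₁ , e₂ , e₃) = e₁ , e₂ , P.cong (_·M μ) e₃

    *P-rmulMon : ∀ μ (p q : Poly c n) → p *P map (rmulMon μ) q ≋ map (rmulMon μ) (p *P q)
    *P-rmulMon μ []      q = []
    *P-rmulMon μ (σ ∷ p) q = ≋-trans (≋-reflexive (*P-∷ σ p (map (rmulMon μ) q)))
      (≋-trans (Pointwise.++⁺ (reassociate q) (*P-rmulMon μ p q))
               (≋-reflexive (P.sym (P.trans (P.cong (map (rmulMon μ)) (*P-∷ σ p q))
                                            (LP.map-++ (rmulMon μ) (map (lmulTerm σ) q) (p *P q))))))
      where
      reassociate : ∀ r → map (lmulTerm σ) (map (rmulMon μ) r) ≋ map (rmulMon μ) (map (lmulTerm σ) r)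
      reassociate []      = []
      reassociate (τ ∷ r) = (refl , P.refl , P.sym (·M-assoc (mon σ) (mon τ) μ)) ∷ reassociate r

    prodAt : PolyMap c n → Poly c n → List (Fin n) → Poly c n
    prodAt G = foldr (λ i r → G i *P r)

    prodAt-congʳ : ∀ (G : PolyMap c n) ls {r r′} → r ≋ r′ → prodAt G r ls ≋ prodAt G r′ ls
    prodAt-congʳ G []       e = e
    prodAt-congʳ G (l ∷ ls) e = *P-congʳ (G l) (prodAt-congʳ G ls e)

    prodAt-rmulMon : ∀ (G : PolyMap c n) μ ls → prodAt G (term 1# 0 μ ∷ []) ls ≋ map (rmulMon μ) (prodAt G oneP ls)
    prodAt-rmulMon G μ []       = (refl , P.refl , P.sym (·M-identityˡ μ)) ∷ []
    prodAt-rmulMon G μ (l ∷ ls) = ≋-trans (*P-congʳ (G l) (prodAt-rmulMon G μ ls)) (*P-rmulMon μ (G l) _)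

    monAt-varMon : ∀ (G : PolyMap c n) i → monAt G (varMon i) ≋ G i
    monAt-varMon G i rewrite letters-varMon {c} i = *P-oneP (G i)

    substTerm : PolyMap c n → Term c n → Poly c n
    substTerm G τ = (term (coef τ) (tpow τ) oneMon ∷ []) *P monAt G (mon τ)

    substTerm-≋ : ∀ G τ → substTerm G τ ≋ map (lmulTerm (term (coef τ) (tpow τ) oneMon)) (monAt G (mon τ))
    substTerm-≋ G τ = ≋-reflexive (LP.++-identityʳ _)

    substP-++ : ∀ G (p q : Poly c n) → substP G (p ++ q) ≡ substP G p ++ substP G q
    substP-++ G = LP.concatMap-++ (substTerm G)

    substP-concatMap : ∀ {b} {A : Set b} G (f : A → Poly c n) xs →
      substP G (concatMap f xs) ≡ concatMap (substP G ∘ f) xs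
    substP-concatMap G f []       = P.refl
    substP-concatMap G f (x ∷ xs) =
      P.trans (substP-++ G (f x) (concatMap f xs)) (P.cong (substP G (f x) ++_) (substP-concatMap G f xs))

    substP-varP : ∀ G i → substP G (varP i) ≋ G i
    substP-varP G i = ≋-trans (≋-reflexive (LP.++-identityʳ _)) (≋-trans (substTerm-≋ G (term 1# 0 (varMon i)))
      (≋-trans (≋-map _ id _ (λ τ → *-identityˡ _ , P.refl , ·M-identityˡ _))
               (≋-trans (≋-reflexive (LP.map-id _)) (monAt-varMon G i))))

    substP-negP : ∀ G (p : Poly c n) → substP G (negP p) ≋ negP (substP G p)
    substP-negP G []      = []
    substP-negP G (τ ∷ p) =
      ≋-trans (Pointwise.++⁺ substTerm-neg (substP-negP G p)) (≋-reflexive (P.sym (LP.map-++ neg (substTerm G τ) (substP G p))))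
      where
      neg : Term c n → Term c n
      neg σ = term (- coef σ) (tpow σ) (mon σ)
      substTerm-neg : substTerm G (neg τ) ≋ map neg (substTerm G τ)
      substTerm-neg =
        ≋-trans (substTerm-≋ G (neg τ))
        (≋-trans (≋-map _ (neg ∘ lmulTerm (term (coef τ) (tpow τ) oneMon)) (monAt G (mon τ))
                        (λ ρ → sym (-‿distribˡ-* _ _) , P.refl , P.refl))
        (≋-trans (≋-reflexive (LP.map-∘ (monAt G (mon τ))))
                 (≋-map-cong neg (λ (e₁ , e₂ , e₃) → -‿cong e₁ , e₂ , e₃) (≋-sym (substTerm-≋ G τ)))))

    t⁰part : Poly c n → Poly c n
    t⁰part []                     = []
    t⁰part (term x zero m ∷ p)    = term x zero m ∷ t⁰part p
    t⁰part (term x (suc k) m ∷ p) = t⁰part p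

    coeff-t⁰part : ∀ (p : Poly c n) m → coeff p 0 m ≈ coeff (t⁰part p) 0 m
    coeff-t⁰part []                     m = refl
    coeff-t⁰part (term x zero m′ ∷ p)   m with m′ ≟M m
    ... | yes _ = +-congˡ (coeff-t⁰part p m)
    ... | no _  = coeff-t⁰part p m
    coeff-t⁰part (term x (suc k) m′ ∷ p) m = coeff-t⁰part p m

    t⁰part-++ : ∀ (p q : Poly c n) → t⁰part (p ++ q) ≡ t⁰part p ++ t⁰part q
    t⁰part-++ []                     q = P.refl
    t⁰part-++ (term x zero m ∷ p)    q = P.cong (term x zero m ∷_) (t⁰part-++ p q)
    t⁰part-++ (term x (suc k) m ∷ p) q = t⁰part-++ p q

    t⁰part-positive : ∀ (p : Poly c n) → All (λ τ → tpow τ ≢ 0) p → t⁰part p ≡ []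
    t⁰part-positive []                     []       = P.refl
    t⁰part-positive (term x zero m ∷ p)    (h ∷ hs) = contradiction P.refl h
    t⁰part-positive (term x (suc k) m ∷ p) (_ ∷ hs) = t⁰part-positive p hs

    t⁰part-*P : ∀ (p q : Poly c n) → t⁰part (p *P q) ≡ t⁰part p *P t⁰part q
    t⁰part-*P []                     q = P.refl
    t⁰part-*P (term x zero m ∷ p)    q =
      P.trans (t⁰part-++ (map (lmulTerm (term x zero m)) q) (p *P q)) (P.cong₂ _++_ (at-zero q) (t⁰part-*P p q))
      where
      at-zero : ∀ q → t⁰part (map (lmulTerm (term x 0 m)) q) ≡ map (lmulTerm (term x 0 m)) (t⁰part q)
      at-zero []                      = P.refl
      at-zero (term y zero μ ∷ q)     = P.cong (_ ∷_) (at-zero q)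
      at-zero (term y (suc j) μ ∷ q)  = at-zero q
    t⁰part-*P (term x (suc k) m ∷ p) q =
      P.trans (t⁰part-++ (map (lmulTerm (term x (suc k) m)) q) (p *P q))
              (P.trans (P.cong (_++ t⁰part (p *P q)) (at-suc q)) (t⁰part-*P p q))
      where
      at-suc : ∀ q → t⁰part (map (lmulTerm (term x (suc k) m)) q) ≡ []
      at-suc []      = P.refl
      at-suc (τ ∷ q) = at-suc q

    monAt-idMap : ∀ (v : Mon c n) → monAt idMap v ≋ term 1# 0 v ∷ []
    monAt-idMap v = ≋-trans (go (letters v)) ((refl , P.refl , prodMon-letters v) ∷ [])
      where
      go : ∀ ls → prodAt idMap oneP ls ≋ term 1# 0 (prodMon ls) ∷ []
      go []       = ≋-refl
      go (l ∷ ls) = ≋-trans (*P-congʳ (varP l) (go ls)) ((*-identityˡ _ , P.refl , P.refl) ∷ [])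

    coeff₀-monAt : ∀ (G : PolyMap c n) → (∀ i → t⁰part (G i) ≡ varP i) → ∀ v m → coeff (monAt G v) 0 m ≈ δ v m
    coeff₀-monAt G G₀ v m = begin
      coeff (monAt G v) 0 m              ≈⟨ coeff-t⁰part (monAt G v) m ⟩
      coeff (t⁰part (monAt G v)) 0 m     ≡⟨ P.cong (λ p → coeff p 0 m) (t⁰part-prodAt (letters v)) ⟩
      coeff (monAt idMap v) 0 m          ≈⟨ coeff-≋ (monAt-idMap v) 0 m ⟩
      coeff (term 1# 0 v ∷ []) 0 m       ≈⟨ coeff-monomial 0 v m ⟩
      δ v m                              ∎
      where
      t⁰part-prodAt : ∀ ls → t⁰part (prodAt G oneP ls) ≡ prodAt idMap oneP ls
      t⁰part-prodAt []       = P.refl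
      t⁰part-prodAt (l ∷ ls) = P.trans (t⁰part-*P (G l) _) (P.cong₂ _*P_ (G₀ l) (t⁰part-prodAt ls))

  JacEntryZero-∉ : ∀ {c n} (p : Poly c n) j → All (λ τ → j ∉ letters (mon τ)) p → JacEntryZero p j
  JacEntryZero-∉ {comm}    p j j∉ k m =
    trans (*-congˡ (coeff-absent p k _ (All.map (λ j∉τ → inj₂ (λ eq → j∉τ (P.subst (λ μ → j ∈ letters μ) (P.sym eq) j∈)))
                                                j∉)))
          (zeroʳ _)
    where j∈ = ∈-letters-updateAt m j
  JacEntryZero-∉ {noncomm} p j j∉ k u v =
    coeff-absent p k _ (All.map (λ j∉τ → inj₂ (λ eq → j∉τ (P.subst (j ∈_) (P.sym eq) j∈))) j∉)
    where j∈ = ∈-++⁺ʳ u (here P.refl)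

  module _ {c : Case} {S : ℕ} where

    mulXtᵏz₀ᵉ : Carrier → ℕ → ℕ → Term c (suc S) → Term c (suc S)
    mulXtᵏz₀ᵉ x k e τ = term (x * coef τ) (k ℕ.+ tpow τ) (mon τ ·M z₀^ e)

    mulXtᵏz₀ᵉ-cong : ∀ x k e {τ σ} → τ ≈ᵗ σ → mulXtᵏz₀ᵉ x k e τ ≈ᵗ mulXtᵏz₀ᵉ x k e σ
    mulXtᵏz₀ᵉ-cong x k e (e₁ , e₂ , e₃) = *-congˡ e₁ , P.cong (k ℕ.+_) e₂ , P.cong (_·M z₀^ e) e₃

    ≐P-mulXtᵏz₀ᵉ : ∀ x k e {p q} → p ≐P q → map (mulXtᵏz₀ᵉ x k e) p ≐P map (mulXtᵏz₀ᵉ x k e) q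
    ≐P-mulXtᵏz₀ᵉ x k e {p} {q} = ≐P-relabel x (NP.+-cancelˡ-≡ k _ _) (·M-cancelʳ _ _ (z₀^ e)) {p} {q}

    module _ (G : PolyMap c (suc S)) (G-z₀ : G z₀ ≡ varP z₀) where

      monAt-·z₀^ : ∀ (m : Mon c (suc S)) e → monAt G (m ·M z₀^ e) ≋ map (rmulMon (z₀^ e)) (monAt G m)
      monAt-·z₀^ m e rewrite letters-·z₀^ m e =
        ≋-trans (≋-reflexive (LP.foldr-++ _ oneP (letters m) (replicate e z₀)))
          (≋-trans (prodAt-congʳ G (letters m) (prodAt-z₀ e)) (prodAt-rmulMon G (z₀^ e) (letters m)))
        where
        prodAt-z₀ : ∀ e → prodAt G oneP (replicate e z₀) ≋ term 1# 0 (z₀^ e) ∷ []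
        prodAt-z₀ zero = ≋-refl
        prodAt-z₀ (suc e) rewrite G-z₀ = ≋-trans (*P-congʳ (varP z₀) (prodAt-z₀ e)) ((*-identityˡ _ , P.refl , P.refl) ∷ [])

      substP-mulXtᵏz₀ᵉ : ∀ x k e (q : Poly c (suc S)) →
        substP G (map (mulXtᵏz₀ᵉ x k e) q) ≋ map (mulXtᵏz₀ᵉ x k e) (substP G q)
      substP-mulXtᵏz₀ᵉ x k e q =
        ≋-trans (≋-reflexive (LP.concatMap-map (substTerm G) (mulXtᵏz₀ᵉ x k e) q))
          (≋-trans (≋-concatMap _ _ q substTerm-mulXtᵏz₀ᵉ)
                   (≋-reflexive (P.sym (LP.map-concatMap (mulXtᵏz₀ᵉ x k e) (substTerm G) q))))
        where
        substTerm-mulXtᵏz₀ᵉ : ∀ τ → substTerm G (mulXtᵏz₀ᵉ x k e τ) ≋ map (mulXtᵏz₀ᵉ x k e) (substTerm G τ)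
        substTerm-mulXtᵏz₀ᵉ τ =
          ≋-trans (substTerm-≋ G (mulXtᵏz₀ᵉ x k e τ))
          (≋-trans (≋-map-cong (lmulTerm _) (lmulTerm-congʳ _) (monAt-·z₀^ (mon τ) e))
          (≋-trans (≋-reflexive (P.sym (LP.map-∘ (monAt G (mon τ)))))
          (≋-trans (≋-map _ _ (monAt G (mon τ))
                     (λ ρ → *-assoc _ _ _ , NP.+-assoc k (tpow τ) (tpow ρ)
                          , P.trans (·M-identityˡ _) (P.cong (_·M z₀^ e) (P.sym (·M-identityˡ (mon ρ))))))
          (≋-trans (≋-reflexive (LP.map-∘ (monAt G (mon τ))))
                   (≋-map-cong (mulXtᵏz₀ᵉ x k e) (mulXtᵏz₀ᵉ-cong x k e) (≋-sym (substTerm-≋ G τ)))))))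

      substTerm-var·z₀^ : ∀ x k v e → substTerm G (term x k (varMon v ·M z₀^ e)) ≋ map (mulXtᵏz₀ᵉ x k e) (G v)
      substTerm-var·z₀^ x k v e =
        ≋-trans (substTerm-≋ G _)
        (≋-trans (≋-map-cong (lmulTerm _) (lmulTerm-congʳ _)
                              (≋-trans (monAt-·z₀^ (varMon v) e)
                                       (≋-map-cong (rmulMon (z₀^ e)) (rmulMon-cong (z₀^ e)) (monAt-varMon G v))))
        (≋-trans (≋-reflexive (P.sym (LP.map-∘ (G v)))) (≋-map _ _ (G v) (λ ρ → refl , P.refl , ·M-identityˡ _))))

  -- Sums over the monomials of bounded degree

  module _ {n : ℕ} (words : ℕ → List (List (Fin n)))
           (words-zero : words 0 ≡ [] ∷ [])
           (words-suc : ∀ L → words (suc L) ≡ concatMap (λ i → map (i ∷_) (words L)) (allFin n)) where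

    private
      sumMap-words-δ : ∀ L (h : List (Fin n) → Carrier) T → (∀ w → w ≢ T → h w ≈ 0#) →
        (length T ≡ L → sumMap h (words L) ≈ h T) × (length T ≢ L → sumMap h (words L) ≈ 0#)
      sumMap-words-δ zero    h []      z rewrite words-zero = (λ _ → +-identityʳ _) , (λ ne → contradiction P.refl ne)
      sumMap-words-δ zero    h (t ∷ T) z rewrite words-zero = (λ ()) , (λ _ → trans (+-identityʳ _) (z [] (λ ())))
      sumMap-words-δ (suc L) h T z rewrite words-suc L = by-first-letter T z
        where
        split : sumMap h (concatMap (λ i → map (i ∷_) (words L)) (allFin n))
                ≈ sumMap (λ i → sumMap (h ∘ (i ∷_)) (words L)) (allFin n)
        split = trans (sumMap-concatMap h _ (allFin n)) (sumMap-cong (allFin n) (λ i → sumMap-map h (i ∷_) (words L)))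
        by-first-letter : ∀ T → (∀ w → w ≢ T → h w ≈ 0#) →
          (length T ≡ suc L → sumMap h (concatMap (λ i → map (i ∷_) (words L)) (allFin n)) ≈ h T) ×
          (length T ≢ suc L → sumMap h (concatMap (λ i → map (i ∷_) (words L)) (allFin n)) ≈ 0#)
        by-first-letter []       z =
          (λ ()) , (λ _ → trans split (sumMap-zero (allFin n) (λ i → sumMap-zero (words L) (λ w → z (i ∷ w) (λ ())))))
        by-first-letter (t ∷ T′) z =
            (λ e  → trans split (trans (sumMap-allFin-δ n _ t others) (proj₁ rest (NP.suc-injective e))))
          , (λ ne → trans split (trans (sumMap-allFin-δ n _ t others) (proj₂ rest (ne ∘ P.cong suc))))
          where
          rest = sumMap-words-δ L (h ∘ (t ∷_)) T′ (λ w ne → z (t ∷ w) (ne ∘ LP.∷-injectiveʳ))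
          others : ∀ i → i ≢ t → sumMap (h ∘ (i ∷_)) (words L) ≈ 0#
          others i ne = sumMap-zero (words L) (λ w → z (i ∷ w) (ne ∘ LP.∷-injectiveˡ))

    sumMap-wordsUpTo-δ : ∀ N (h : List (Fin n) → Carrier) T → (∀ w → w ≢ T → h w ≈ 0#) →
      (length T ≤ N → sumMap h (concatMap words (upTo (suc N))) ≈ h T) ×
      (¬ length T ≤ N → sumMap h (concatMap words (upTo (suc N))) ≈ 0#)
    sumMap-wordsUpTo-δ N h T z =
        (λ le → trans by-length
                  (trans (sumMap-upTo-δ (suc N) _ (length T) (s≤s le) (λ L _ ne → proj₂ (sumMap-words-δ L h T z) (ne ∘ P.sym)))
                         (proj₁ (sumMap-words-δ (length T) h T z) P.refl)))
      , (λ nle → trans by-length (sumMap-upTo-zero (suc N) _ (λ L L< → proj₂ (sumMap-words-δ L h T z)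
                                                                  (λ e → nle (NP.≤-trans (NP.≤-reflexive e) (NP.≤-pred L<))))))
      where
      by-length : sumMap h (concatMap words (upTo (suc N))) ≈ sumMap (λ L → sumMap h (words L)) (upTo (suc N))
      by-length = sumMap-concatMap h words (upTo (suc N))

  module _ (vecs : ∀ n → ℕ → List (Vec ℕ n))
           (vecs-zero : ∀ N → vecs 0 N ≡ [] ∷ [])
           (vecs-suc : ∀ n N → vecs (suc n) N ≡ concatMap (λ x → map (x ∷_) (vecs n (N ∸ x))) (upTo (suc N))) where

    sumMap-vecs-δ : ∀ n N (h : Vec ℕ n → Carrier) T → (∀ w → w ≢ T → h w ≈ 0#) →
      (Vec.sum T ≤ N → sumMap h (vecs n N) ≈ h T) × (¬ Vec.sum T ≤ N → sumMap h (vecs n N) ≈ 0#)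
    sumMap-vecs-δ zero    N h []       z rewrite vecs-zero N = (λ _ → +-identityʳ _) , (λ nle → contradiction z≤n nle)
    sumMap-vecs-δ (suc n) N h (t ∷ T′) z rewrite vecs-suc n N =
        (λ le → trans split
                  (trans (sumMap-upTo-δ (suc N) byHead t (s≤s (NP.≤-trans (NP.m≤m+n t (Vec.sum T′)) le)) (λ x _ → others x))
                         (proj₁ rest (tail-bound le))))
      , (λ nle → trans split (too-large nle))
      where
      byHead : ℕ → Carrier
      byHead x = sumMap (h ∘ (x ∷_)) (vecs n (N ∸ x))
      split : sumMap h (concatMap (λ x → map (x ∷_) (vecs n (N ∸ x))) (upTo (suc N))) ≈ sumMap byHead (upTo (suc N))
      split = trans (sumMap-concatMap h (λ x → map (x ∷_) (vecs n (N ∸ x))) (upTo (suc N)))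
                    (sumMap-cong (upTo (suc N)) (λ x → sumMap-map h (x ∷_) (vecs n (N ∸ x))))
      rest = sumMap-vecs-δ n (N ∸ t) (h ∘ (t ∷_)) T′ (λ w ne → z (t ∷ w) (ne ∘ P.cong Vec.tail))
      others : ∀ x → x ≢ t → byHead x ≈ 0#
      others x ne = sumMap-zero (vecs n (N ∸ x)) (λ w → z (x ∷ w) (ne ∘ P.cong Vec.head))
      tail-bound : t ℕ.+ Vec.sum T′ ≤ N → Vec.sum T′ ≤ N ∸ t
      tail-bound le = NP.≤-trans (NP.≤-reflexive (P.sym (NP.m+n∸m≡n t (Vec.sum T′)))) (NP.∸-monoˡ-≤ t le)
      too-large : ¬ t ℕ.+ Vec.sum T′ ≤ N → sumMap byHead (upTo (suc N)) ≈ 0#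
      too-large nle with t ℕ.<? suc N
      ... | no t≮ = sumMap-upTo-zero (suc N) byHead (λ x x< → others x (λ e → t≮ (P.subst (_< suc N) e x<)))
      ... | yes t< = trans (sumMap-upTo-δ (suc N) byHead t t< (λ x _ → others x))
                           (proj₂ rest (λ le → nle (NP.≤-trans (NP.+-monoʳ-≤ t le)
                                                                (NP.≤-reflexive (NP.m+[n∸m]≡n (NP.≤-pred t<))))))

  sumMap-monsUpTo-δ : ∀ c n N (h : Mon c n → Carrier) T → (∀ w → w ≢ T → h w ≈ 0#) →
    (degree T ≤ N → sumMap h (monsUpTo c n N) ≈ h T) × (¬ degree T ≤ N → sumMap h (monsUpTo c n N) ≈ 0#)
  sumMap-monsUpTo-δ comm    n N = sumMap-vecs-δ (monsUpTo comm) (λ _ → P.refl) (λ _ _ → P.refl) n N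
  sumMap-monsUpTo-δ noncomm n N = sumMap-wordsUpTo-δ (proj₁ wordsOfLen) P.refl (λ _ → P.refl) N
    where
    -- The private enumeration of words in Defs, recovered by unification from its unfolding.
    wordsOfLen : Σ (ℕ → List (List (Fin n))) λ words →
      ∀ N → monsUpTo noncomm n N ≡ [] ∷ concat (map words (applyUpTo suc N))
    wordsOfLen = _ , λ _ → P.refl

  -- The operators f_k

  module _ {c : Case} {n : ℕ} (F : PolyMap c n) where

    -- Comparing coefficients of t^k in f(-t) u = u(F) for u independent of t forces this formula.
    generator : ℕ → Series c n → Series c n
    generator k u m = negPow k (sumMap (λ v → u v * coeff (monAt F v) k m) (monsUpTo c n (degree m)))

    generator-linear : ∀ k → IsLinearOp (generator k)
    generator-linear k = record
      { cong-op  = λ u v e m → negPow-cong k (sumMap-cong (mons m) (λ w → *-congʳ (e w)))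
      ; additive = λ u v m → trans (negPow-cong k (trans (sumMap-cong (mons m) (λ w → distribʳ _ _ _)) (sumMap-+ _ _ (mons m))))
                                   (negPow-+ k _ _)
      ; homogen  = λ x u m → trans (negPow-cong k (trans (sumMap-cong (mons m) (λ w → *-assoc _ _ _)) (sumMap-*ˡ x _ (mons m))))
                                   (negPow-* k _ _)
      }
      where
      mons : Mon c n → List (Mon c n)
      mons m = monsUpTo c n (degree m)

    generator-zero : (∀ i → t⁰part (F i) ≡ varP i) → ∀ u m → generator 0 u m ≈ u m
    generator-zero F₀ u m = begin
      sumMap (λ v → u v * coeff (monAt F v) 0 m) (monsUpTo c n (degree m))
        ≈⟨ proj₁ (sumMap-monsUpTo-δ c n (degree m) _ m
                   (λ w w≢m → trans (*-congˡ (trans (coeff₀-monAt F F₀ w m) (δ-off w m w≢m))) (zeroʳ _))) NP.≤-refl ⟩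
      u m * coeff (monAt F m) 0 m  ≈⟨ *-congˡ (trans (coeff₀-monAt F F₀ m m) (δ-diag m)) ⟩
      u m * 1#                     ≈⟨ *-identityʳ _ ⟩
      u m                          ∎

    generator-equation : ∀ (u : TSeries c n) k m →
      sumMap (λ b → negPow b (generator b (u (k ∸ b)) m)) (upTo (suc k)) ≈ compose u F k m
    generator-equation u k m = begin
      sumMap (λ b → negPow b (generator b (u (k ∸ b)) m)) (upTo (suc k))
        ≈⟨ sumMap-cong (upTo (suc k)) (λ b → negPow-involutive b _) ⟩
      sumMap (λ b → H (k ∸ b) b) (upTo (suc k))   ≈⟨ sumMap-upTo-reverse k H ⟩
      sumMap (λ b → H b (k ∸ b)) (upTo (suc k))   ∎
      where
      H : ℕ → ℕ → Carrier
      H a b = sumMap (λ v → u a v * coeff (monAt F v) b m) (monsUpTo c n (degree m))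

    module _ (u : Series c n) (μ : Mon c n) (u-support : ∀ v → v ≢ μ → u v ≈ 0#) (k : ℕ) (m : Mon c n) where

      private
        sum-at-μ = sumMap-monsUpTo-δ c n (degree m) (λ v → u v * coeff (monAt F v) k m) μ
                     (λ v v≢μ → trans (*-congʳ (u-support v v≢μ)) (zeroˡ _))

      generator-supported : degree μ ≤ degree m → generator k u m ≈ negPow k (u μ * coeff (monAt F μ) k m)
      generator-supported = negPow-cong k ∘ proj₁ sum-at-μ

      generator-supported-vanishes : ¬ degree μ ≤ degree m → generator k u m ≈ 0#
      generator-supported-vanishes μ≰m = trans (negPow-cong k (proj₂ sum-at-μ μ≰m)) (negPow-0# k)

    generator-isGenerator : (∀ i → t⁰part (F i) ≡ varP i) → IsGenerator F generator
    generator-isGenerator F₀ = record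
      { linear = generator-linear ; f0 = generator-zero F₀ ; eqn = generator-equation }

    module _ {f : ℕ → Series c n → Series c n} (isGen : IsGenerator F f) where
      open IsGenerator isGen

      -- Test the equation on u concentrated at t⁰: only b = k survives on the left and b = 0 on the right.
      generator-unique : ∀ k u m → f k u m ≈ generator k u m
      generator-unique k u m = begin
        f k u m                       ≈⟨ sym (negPow-involutive k _) ⟩
        negPow k (negPow k (f k u m)) ≈⟨ negPow-cong k (trans (sym lhs) (trans (eqn ut k m) rhs)) ⟩
        generator k u m               ∎
        where
        ut : TSeries c n
        ut zero    = u
        ut (suc _) = λ _ → 0#
        f-0 : ∀ b m → f b (λ _ → 0#) m ≈ 0#
        f-0 b m = trans (IsLinearOp.cong-op (linear b) _ (λ _ → 0# * 0#) (λ _ → sym (zeroˡ 0#)) m)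
                        (trans (IsLinearOp.homogen (linear b) 0# (λ _ → 0#) m) (zeroˡ _))
        lhs : sumMap (λ b → negPow b (f b (ut (k ∸ b)) m)) (upTo (suc k)) ≈ negPow k (f k u m)
        lhs = trans (sumMap-upTo-δ (suc k) _ k NP.≤-refl below-k)
                    (reflexive (P.cong (λ j → negPow k (f k (ut j) m)) (NP.n∸n≡0 k)))
          where
          below-k : ∀ b → b < suc k → b ≢ k → negPow b (f b (ut (k ∸ b)) m) ≈ 0#
          below-k b b< b≢k with k ∸ b | NP.m>n⇒m∸n≢0 (NP.≤∧≢⇒< (NP.≤-pred b<) b≢k)
          ... | zero  | k∸b≢0 = contradiction P.refl k∸b≢0
          ... | suc _ | _     = trans (negPow-cong b (f-0 b m)) (negPow-0# b)
        rhs : compose ut F k m ≈ sumMap (λ v → u v * coeff (monAt F v) k m) (monsUpTo c n (degree m))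
        rhs = sumMap-upTo-δ (suc k) _ 0 (s≤s z≤n) λ where
          zero    _ 0≢0 → contradiction P.refl 0≢0
          (suc b) _ _   → sumMap-zero (monsUpTo c n (degree m)) (λ v → zeroˡ _)

      𝒮-unique : ∀ P u m → 𝒮 f P u m ≈ 𝒮 generator P u m
      𝒮-unique P u m = sumMap-cong P (λ (x , w) → *-congˡ (opWord-unique w m))
        where
        opWord-unique : ∀ w m → opWord f w u m ≈ opWord generator w u m
        opWord-unique []      m = refl
        opWord-unique (i ∷ w) m =
          trans (IsLinearOp.cong-op (linear (suc i)) _ _ (opWord-unique w) m) (generator-unique (suc i) _ m)

  -- The automorphism separating the words of P

  module Construction (c : Case) (MM LL e : ℕ) where

    open TreeVertices MM

    S n : ℕ
    S = Base ^ LL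
    n = suc S

    y : (s : ℕ) → s < S → Fin n
    y s s<S = fromℕ< (NP.m<n⇒m<1+n s<S)

    toℕ-y : ∀ s s<S → toℕ (y s s<S) ≡ s
    toℕ-y s s<S = FP.toℕ-fromℕ< (NP.m<n⇒m<1+n s<S)

    z₀≮S : ¬ toℕ (z₀ {S}) < S
    z₀≮S = NP.<-irrefl (FP.toℕ-fromℕ S)

    yz : Fin n → ℕ → Mon c n
    yz v e′ = varMon v ·M z₀^ e′

    letters-yz : ∀ v e′ → letters (yz v e′) ≡ v ∷ replicate e′ z₀
    letters-yz v e′ = P.trans (letters-·z₀^ (varMon {c} v) e′) (P.cong (_++ replicate e′ z₀) (letters-varMon {c} v))

    degree-yz : ∀ v e′ → degree (yz v e′) ≡ suc e′
    degree-yz v e′ =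
      P.trans (degree-·M {c} (varMon v) (z₀^ e′)) (P.cong₂ ℕ._+_ (degree-varMon {c} v) (degree-z₀^ {c} {S} e′))

    yz-injective : ∀ {v v′ e′ e″} → yz v e′ ≡ yz v′ e″ → v ≡ v′
    yz-injective {v} {v′} {e′} {e″} eq =
      LP.∷-injectiveˡ (P.trans (P.sym (letters-yz v e′)) (P.trans (P.cong letters eq) (letters-yz v′ e″)))

    hTerm : ℕ → ℕ → Poly c n
    hTerm s i with child s i ℕ.<? S
    ... | yes lt = term 1# (suc i) (yz (y (child s i) lt) e) ∷ []
    ... | no _   = []

    Hy : ℕ → Poly c n
    Hy s = concatMap (hTerm s) (upTo MM)

    H : PolyMap c n
    H v with toℕ v ℕ.<? S
    ... | yes _ = Hy (toℕ v)
    ... | no _  = []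

    H-y : ∀ v → toℕ v < S → H v ≡ Hy (toℕ v)
    H-y v v<S with toℕ v ℕ.<? S
    ... | yes _   = P.refl
    ... | no v≮S = contradiction v<S v≮S

    H-beyond : ∀ v → ¬ toℕ v < S → H v ≡ []
    H-beyond v v≮S with toℕ v ℕ.<? S
    ... | yes v<S = contradiction v<S v≮S
    ... | no _    = P.refl

    F : PolyMap c n
    F v = varP v +P negP (H v)

    F-beyond : ∀ v → ¬ toℕ v < S → F v ≡ varP v
    F-beyond v v≮S rewrite H-beyond v v≮S = P.refl

    F-z₀ : F z₀ ≡ varP z₀
    F-z₀ = F-beyond z₀ z₀≮S

    IsHTerm : ℕ → Term c n → Set a
    IsHTerm s τ = ∃ λ i → ∃ λ (lt : child s i < S) → τ ≡ term 1# (suc i) (yz (y (child s i) lt) e)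

    H-terms : ∀ v → All (IsHTerm (toℕ v)) (H v)
    H-terms v with toℕ v ℕ.<? S
    ... | yes _ = go (upTo MM)
      where
      hTerm-terms : ∀ i → All (IsHTerm (toℕ v)) (hTerm (toℕ v) i)
      hTerm-terms i with child (toℕ v) i ℕ.<? S
      ... | yes lt = (i , lt , P.refl) ∷ []
      ... | no _   = []
      go : ∀ is → All (IsHTerm (toℕ v)) (concatMap (hTerm (toℕ v)) is)
      go []       = []
      go (i ∷ is) = All-++⁺ (hTerm-terms i) (go is)
    ... | no _  = []

    d : ℕ
    d = suc e

    homogeneous : ∀ v k m → ¬ degree m ≡ d → coeff (H v) k m ≈ 0#
    homogeneous v k m deg≢d = coeff-absent (H v) k m (All.map of-degree-d (H-terms v))
      where
      of-degree-d : ∀ {τ} → IsHTerm (toℕ v) τ → tpow τ ≢ k ⊎ mon τ ≢ m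
      of-degree-d (_ , _ , P.refl) = inj₂ (λ eq → deg≢d (P.trans (P.cong degree (P.sym eq)) (degree-yz _ e)))

    H-vanishes-at-t⁰ : ∀ v m → coeff (H v) 0 m ≈ 0#
    H-vanishes-at-t⁰ v m = coeff-absent (H v) 0 m (All.map (λ { (_ , _ , P.refl) → inj₁ (λ ()) }) (H-terms v))

    t⁰part-F : ∀ v → t⁰part (F v) ≡ varP v
    t⁰part-F v = P.trans (t⁰part-++ (varP v) (negP (H v)))
      (P.cong (varP v ++_) (t⁰part-positive (negP (H v)) (negP-positive (H v) (All.map (λ { (_ , _ , P.refl) () }) (H-terms v)))))
      where
      negP-positive : ∀ p → All (λ τ → tpow τ ≢ 0) p → All (λ τ → tpow τ ≢ 0) (negP p)
      negP-positive []      []       = []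
      negP-positive (τ ∷ p) (h ∷ hs) = h ∷ negP-positive p hs

    -- H(y_s) only involves z₀ and the y_{child s i}, all of larger index than y_s.
    σ : Permutation′ n
    σ = Permutation.reverse

    triangular : ∀ v j → ¬ (σ ⟨$⟩ʳ j) Fin.< (σ ⟨$⟩ʳ v) → JacEntryZero (H v) j
    triangular v j σj≮σv = JacEntryZero-∉ (H v) j (All.map j∉ (H-terms v))
      where
      j≤v : toℕ j ≤ toℕ v
      j≤v = NP.≮⇒≥ (λ v<j → σj≮σv (P.subst₂ _<_ (P.sym (FP.opposite-prop j)) (P.sym (FP.opposite-prop v))
                                                (NP.∸-monoʳ-< {n} (s≤s v<j) (FP.toℕ<n j))))
      j∉ : ∀ {τ} → IsHTerm (toℕ v) τ → j ∉ letters (mon τ)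
      j∉ (i , lt , P.refl) j∈ with P.subst (j ∈_) (letters-yz _ e) j∈
      ... | here j≡y = NP.<⇒≱ (s<child (toℕ v) i)
                         (NP.≤-trans (NP.≤-reflexive (P.trans (P.sym (toℕ-y _ lt)) (P.cong toℕ (P.sym j≡y)))) j≤v)
      ... | there j∈z₀s = NP.<⇒≱ (NP.<-trans (s<child (toℕ v) i) lt)
                            (NP.≤-trans (NP.≤-reflexive (P.sym (P.trans (P.cong toℕ (∈-replicate j∈z₀s)) (FP.toℕ-fromℕ S))))
                                        j≤v)
        where
        ∈-replicate : ∀ {k} → j ∈ replicate k z₀ → j ≡ z₀
        ∈-replicate {suc k} (here j≡z₀) = j≡z₀
        ∈-replicate {suc k} (there j∈)  = ∈-replicate j∈

    hTermAt : PolyMap c n → ℕ → ℕ → Poly c n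
    hTermAt G s i with child s i ℕ.<? S
    ... | yes lt = map (mulXtᵏz₀ᵉ 1# (suc i) e) (G (y (child s i) lt))
    ... | no _   = []

    HyAt : PolyMap c n → ℕ → Poly c n
    HyAt G s = concatMap (hTermAt G s) (upTo MM)

    substP-Hy : ∀ (G : PolyMap c n) → G z₀ ≡ varP z₀ → ∀ s → substP G (Hy s) ≋ HyAt G s
    substP-Hy G G-z₀ s = ≋-trans (≋-reflexive (substP-concatMap G (hTerm s) (upTo MM))) (≋-concatMap _ _ (upTo MM) substP-hTerm)
      where
      substP-hTerm : ∀ i → substP G (hTerm s i) ≋ hTermAt G s i
      substP-hTerm i with child s i ℕ.<? S
      ... | yes lt = ≋-trans (≋-reflexive (LP.++-identityʳ _)) (substTerm-var·z₀^ G G-z₀ 1# (suc i) (y (child s i) lt) e)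
      ... | no _   = []

    HyAt-cong : ∀ (G G′ : PolyMap c n) s → (∀ i lt → G (y (child s i) lt) ≡ G′ (y (child s i) lt)) →
      HyAt G s ≡ HyAt G′ s
    HyAt-cong G G′ s eq = LP.concatMap-cong agree (upTo MM)
      where
      agree : ∀ i → hTermAt G s i ≡ hTermAt G′ s i
      agree i with child s i ℕ.<? S
      ... | yes lt = P.cong (map (mulXtᵏz₀ᵉ 1# (suc i) e)) (eq i lt)
      ... | no _   = P.refl

    -- The inverse G satisfies G(y_s) = y_s + H(y_s)[y ↦ G(y)]; as H(y_s) only involves variables
    -- of larger index, iterating this equation S ∸ s times already gives G(y_s).
    approx : ℕ → PolyMap c n
    approx zero    v = varP v
    approx (suc h) v with toℕ v ℕ.<? S
    ... | yes _ = varP v ++ HyAt (approx h) (toℕ v)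
    ... | no _  = varP v

    approx-y : ∀ h v → toℕ v < S → approx (suc h) v ≡ varP v ++ HyAt (approx h) (toℕ v)
    approx-y h v v<S with toℕ v ℕ.<? S
    ... | yes _   = P.refl
    ... | no v≮S = contradiction v<S v≮S

    approx-beyond : ∀ h v → ¬ toℕ v < S → approx h v ≡ varP v
    approx-beyond zero    v v≮S = P.refl
    approx-beyond (suc h) v v≮S with toℕ v ℕ.<? S
    ... | yes v<S = contradiction v<S v≮S
    ... | no _    = P.refl

    fuel-child : ∀ s {h} i (lt : child s i < S) → S ∸ s ≤ suc h → S ∸ toℕ (y (child s i) lt) ≤ h
    fuel-child s {h} i lt le rewrite toℕ-y (child s i) lt =
      NP.≤-trans (NP.∸-monoʳ-≤ S (s<child s i))
                 (NP.≤-trans (NP.≤-reflexive (P.sym (NP.pred[m∸n]≡m∸[1+n] S s))) (NP.pred-mono-≤ le))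

    no-fuel : ∀ (v : Fin n) → S ∸ toℕ v ≤ 0 → ¬ toℕ v < S
    no-fuel v le v<S = NP.<⇒≢ (NP.m<n⇒0<n∸m v<S) (P.sym (NP.n≤0⇒n≡0 le))

    approx-stable : ∀ h v → S ∸ toℕ v ≤ h → approx (suc h) v ≡ approx h v
    approx-stable zero    v le = approx-beyond 1 v (no-fuel v le)
    approx-stable (suc h) v le with toℕ v ℕ.<? S
    ... | yes v<S = P.cong (varP v ++_)
      (HyAt-cong (approx (suc h)) (approx h) (toℕ v) (λ i lt → approx-stable h _ (fuel-child (toℕ v) i lt le)))
    ... | no _    = P.refl

    inverse : PolyMap c n
    inverse = approx S

    inverse-z₀ : inverse z₀ ≡ varP z₀
    inverse-z₀ = approx-beyond S z₀ z₀≮S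

    S≡1+pred : S ≡ suc (ℕ.pred S)
    S≡1+pred = P.sym (NP.suc-pred S {{NP.m^n≢0 Base LL}})

    left-inverse : ∀ v → substP inverse (F v) ≐P varP v
    left-inverse v = by-cases (toℕ v ℕ.<? S)
      where
      by-cases : Dec (toℕ v < S) → substP inverse (F v) ≐P varP v
      by-cases (no v≮S) k m = coeff-≋ (≋-trans (≋-reflexive (P.cong (substP inverse) (F-beyond v v≮S)))
                                   (≋-trans (substP-varP inverse v) (≋-reflexive (approx-beyond S v v≮S)))) k m
      by-cases (yes v<S) k m = begin
        coeff (substP inverse (F v)) k m
          ≡⟨ P.cong (λ p → coeff p k m) (substP-++ inverse (varP v) (negP (H v))) ⟩
        coeff (substP inverse (varP v) ++ substP inverse (negP (H v))) k m
          ≈⟨ coeff-++ (substP inverse (varP v)) (substP inverse (negP (H v))) k m ⟩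
        coeff (substP inverse (varP v)) k m + coeff (substP inverse (negP (H v))) k m
          ≈⟨ +-cong (coeff-≋ (≋-trans (substP-varP inverse v) (≋-reflexive G-y)) k m)
                    (trans (coeff-≋ (substP-negP inverse (H v)) k m) (coeff-negP (substP inverse (H v)) k m)) ⟩
        coeff (varP v ++ R) k m + - coeff (substP inverse (H v)) k m
          ≈⟨ +-cong (coeff-++ (varP v) R k m) (-‿cong (coeff-≋ substP-H k m)) ⟩
        (coeff (varP v) k m + coeff R k m) + - coeff R k m
          ≈⟨ x+y-y≈x _ _ ⟩
        coeff (varP v) k m ∎
        where
        s = toℕ v
        R = HyAt (approx (ℕ.pred S)) s
        G-y : inverse v ≡ varP v ++ R
        G-y = P.trans (P.cong (λ h → approx h v) S≡1+pred) (approx-y _ v v<S)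
        fuel : S ∸ s ≤ suc (ℕ.pred S)
        fuel = NP.≤-trans (NP.m∸n≤m S s) (NP.≤-reflexive S≡1+pred)
        substP-H : substP inverse (H v) ≋ R
        substP-H = ≋-trans (≋-reflexive (P.cong (substP inverse) (H-y v v<S)))
          (≋-trans (substP-Hy inverse inverse-z₀ s)
            (≋-reflexive (P.trans (P.cong (λ h → HyAt (approx h) s) S≡1+pred)
              (HyAt-cong _ _ s (λ i lt → approx-stable _ _ (fuel-child s i lt fuel))))))

    right-inverse : ∀ h v → S ∸ toℕ v ≤ h → substP F (approx h v) ≐P varP v
    right-inverse h v le = by-cases h le (toℕ v ℕ.<? S)
      where
      by-cases : ∀ h → S ∸ toℕ v ≤ h → Dec (toℕ v < S) → substP F (approx h v) ≐P varP v
      by-cases h le (no v≮S) k m = coeff-≋ (≋-trans (≋-reflexive (P.cong (substP F) (approx-beyond h v v≮S)))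
                                   (≋-trans (substP-varP F v) (≋-reflexive (F-beyond v v≮S)))) k m
      by-cases zero    le (yes v<S) = contradiction v<S (no-fuel v le)
      by-cases (suc h) le (yes v<S) k m = begin
        coeff (substP F (approx (suc h) v)) k m
          ≡⟨ P.cong (λ p → coeff p k m) (P.trans (P.cong (substP F) (approx-y h v v<S)) (substP-++ F (varP v) R)) ⟩
        coeff (substP F (varP v) ++ substP F R) k m
          ≈⟨ coeff-++ (substP F (varP v)) (substP F R) k m ⟩
        coeff (substP F (varP v)) k m + coeff (substP F R) k m
          ≈⟨ +-cong (coeff-≋ (substP-varP F v) k m) (substP-R k m) ⟩
        coeff (varP v ++ negP (H v)) k m + coeff (H v) k m
          ≈⟨ +-congʳ (trans (coeff-++ (varP v) _ k m) (+-congˡ (coeff-negP (H v) k m))) ⟩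
        (coeff (varP v) k m + - coeff (H v) k m) + coeff (H v) k m
          ≈⟨ x-y+y≈x _ _ ⟩
        coeff (varP v) k m ∎
        where
        s = toℕ v
        R = HyAt (approx h) s
        substP-hTermAt : ∀ i → substP F (hTermAt (approx h) s i) ≐P hTerm s i
        substP-hTermAt i with child s i ℕ.<? S
        ... | no _   = λ _ _ → refl
        ... | yes lt = λ k m → begin
          coeff (substP F (map (mulXtᵏz₀ᵉ 1# (suc i) e) (approx h w))) k m
            ≈⟨ coeff-≋ (substP-mulXtᵏz₀ᵉ F F-z₀ 1# (suc i) e (approx h w)) k m ⟩
          coeff (map (mulXtᵏz₀ᵉ 1# (suc i) e) (substP F (approx h w))) k m
            ≈⟨ ≐P-mulXtᵏz₀ᵉ 1# (suc i) e {substP F (approx h w)} {varP w} (right-inverse h w (fuel-child s i lt le)) k m ⟩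
          coeff (map (mulXtᵏz₀ᵉ 1# (suc i) e) (varP w)) k m
            ≈⟨ coeff-≋ ((*-identityˡ _ , NP.+-identityʳ (suc i) , P.refl) ∷ []) k m ⟩
          coeff (term 1# (suc i) (yz w e) ∷ []) k m ∎
          where w = y (child s i) lt
        substP-R : substP F R ≐P H v
        substP-R k m = begin
          coeff (substP F R) k m
            ≡⟨ P.cong (λ p → coeff p k m) (substP-concatMap F (hTermAt (approx h) s) (upTo MM)) ⟩
          coeff (concatMap (substP F ∘ hTermAt (approx h) s) (upTo MM)) k m
            ≈⟨ ≐P-concatMap _ _ (upTo MM) substP-hTermAt k m ⟩
          coeff (Hy s) k m
            ≡⟨ P.cong (λ p → coeff p k m) (P.sym (H-y v v<S)) ⟩
          coeff (H v) k m ∎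

    isAutomorphism : IsAutomorphism F
    isAutomorphism = inverse , left-inverse , λ v → right-inverse S v (NP.m∸n≤m S (toℕ v))

    𝔹-element : ∀ α → α ≤ d → 𝔹 c α n
    𝔹-element α α≤d = record
      { H = H ; d = d ; α≤d = α≤d ; homog = homogeneous ; vanish-t0 = H-vanishes-at-t⁰
      ; σ = σ ; triangular = triangular ; auto = isAutomorphism }

    rmulMon-negP : ∀ μ (p : Poly c n) → map (rmulMon μ) (negP p) ≡ negP (map (rmulMon μ) p)
    rmulMon-negP μ p = P.trans (P.sym (LP.map-∘ p)) (LP.map-∘ p)

    -- The t^{i+1}-coefficient of (y_s z₀^e′)(F) comes from the single term t^{i+1} y_{child s i} z₀^e of H(y_s).
    coeff-monAt-yz : ∀ s (lt : s < S) e′ i → i < MM → (lt′ : child s i < S) → ∀ m →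
      coeff (monAt F (yz (y s lt) e′)) (suc i) m ≈ - δ (yz (y (child s i) lt′) (e ℕ.+ e′)) m
    coeff-monAt-yz s lt e′ i i<MM lt′ m = begin
      coeff (monAt F (yz v e′)) (suc i) m
        ≈⟨ coeff-≋ expand (suc i) m ⟩
      coeff (map rmul-z₀^e′ (varP v) ++ negP (map rmul-z₀^e′ (Hy s))) (suc i) m
        ≈⟨ coeff-++ (map rmul-z₀^e′ (varP v)) (negP (map rmul-z₀^e′ (Hy s))) (suc i) m ⟩
      coeff (map rmul-z₀^e′ (varP v)) (suc i) m + coeff (negP (map rmul-z₀^e′ (Hy s))) (suc i) m
        ≈⟨ +-cong (coeff-absent (map rmul-z₀^e′ (varP v)) (suc i) m (inj₁ (λ ()) ∷ []))
                  (coeff-negP (map rmul-z₀^e′ (Hy s)) (suc i) m) ⟩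
      0# + - coeff (map rmul-z₀^e′ (Hy s)) (suc i) m
        ≈⟨ +-identityˡ _ ⟩
      - coeff (map rmul-z₀^e′ (Hy s)) (suc i) m
        ≡⟨ P.cong (λ p → - coeff p (suc i) m) (LP.map-concatMap rmul-z₀^e′ (hTerm s) (upTo MM)) ⟩
      - coeff (concatMap (map rmul-z₀^e′ ∘ hTerm s) (upTo MM)) (suc i) m
        ≈⟨ -‿cong (coeff-concatMap (map rmul-z₀^e′ ∘ hTerm s) (upTo MM) (suc i) m) ⟩
      - sumMap (λ i′ → coeff (map rmul-z₀^e′ (hTerm s i′)) (suc i) m) (upTo MM)
        ≈⟨ -‿cong (sumMap-upTo-δ MM _ i i<MM (λ i′ _ → other i′)) ⟩
      - coeff (map rmul-z₀^e′ (hTerm s i)) (suc i) m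
        ≈⟨ -‿cong this ⟩
      - δ (yz w (e ℕ.+ e′)) m ∎
      where
      v = y s lt
      w = y (child s i) lt′
      rmul-z₀^e′ = rmulMon (z₀^ e′)
      expand : monAt F (yz v e′) ≋ map rmul-z₀^e′ (varP v) ++ negP (map rmul-z₀^e′ (Hy s))
      expand = ≋-trans (monAt-·z₀^ F F-z₀ (varMon v) e′)
        (≋-trans (≋-map-cong rmul-z₀^e′ (rmulMon-cong (z₀^ e′)) (monAt-varMon F v))
          (≋-reflexive (P.trans (LP.map-++ rmul-z₀^e′ (varP v) (negP (H v)))
            (P.cong (map rmul-z₀^e′ (varP v) ++_)
              (P.trans (rmulMon-negP (z₀^ e′) (H v))
                (P.cong (negP ∘ map rmul-z₀^e′)
                  (P.trans (H-y v (P.subst (_< S) (P.sym (toℕ-y s lt)) lt)) (P.cong Hy (toℕ-y s lt)))))))))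
      other : ∀ i′ → i′ ≢ i → coeff (map rmul-z₀^e′ (hTerm s i′)) (suc i) m ≈ 0#
      other i′ i′≢i with child s i′ ℕ.<? S
      ... | yes _ = coeff-absent _ (suc i) m (inj₁ (i′≢i ∘ NP.suc-injective) ∷ [])
      ... | no _  = refl
      this : coeff (map rmul-z₀^e′ (hTerm s i)) (suc i) m ≈ δ (yz w (e ℕ.+ e′)) m
      this with child s i ℕ.<? S
      ... | yes _ = trans (coeff-monomial (suc i) _ m)
                          (reflexive (P.cong (λ μ → δ μ m)
                            (P.trans (·M-assoc (varMon w) (z₀^ e) (z₀^ e′)) (P.cong (varMon w ·M_) (z₀^-+ e e′)))))
      ... | no child≮S = contradiction lt′ child≮S

    InRange : List ℕ → Set
    InRange w = All (_< MM) w × length w ≤ LL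

    vertex<S : ∀ w → InRange w → vertex w < S
    vertex<S w (w<MM , |w|≤LL) = NP.≤-trans (vertex-bound w w<MM) (NP.^-monoʳ-≤ Base |w|≤LL)

    leaf : ∀ w → InRange w → Mon c n
    leaf w r = yz (y (vertex w) (vertex<S w r)) (length w ℕ.* e)

    leaf-injective : ∀ {w w′} r r′ → leaf w r ≡ leaf w′ r′ → w ≡ w′
    leaf-injective {w} {w′} r r′ eq = vertex-injective (proj₁ r) (proj₁ r′)
      (P.trans (P.sym (toℕ-y _ (vertex<S w r)))
        (P.trans (P.cong toℕ (yz-injective {e′ = length w ℕ.* e} {e″ = length w′ ℕ.* e} eq)) (toℕ-y _ (vertex<S w′ r′))))

    signExponent : List ℕ → ℕ
    signExponent []      = 0
    signExponent (i ∷ w) = suc i ℕ.+ suc (signExponent w)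

    root : InRange []
    root = [] , z≤n

    generator-step : ∀ w (r : InRange w) i (r′ : InRange (i ∷ w)) σ (u : Series c n) →
      (∀ v → u v ≈ negPow σ (δ (leaf w r) v)) → ∀ m →
      generator F (suc i) u m ≈ negPow (suc i ℕ.+ suc σ) (δ (leaf (i ∷ w) r′) m)
    generator-step w r i r′ σ u u≈ m = by-degree (degree μ ℕ.≤? degree m)
      where
      μ = leaf w r
      μ′ = leaf (i ∷ w) r′
      support : ∀ v → v ≢ μ → u v ≈ 0#
      support v v≢μ = trans (u≈ v) (trans (negPow-cong σ (δ-off μ v (v≢μ ∘ P.sym))) (negPow-0# σ))
      by-degree : Dec (degree μ ≤ degree m) → generator F (suc i) u m ≈ negPow (suc i ℕ.+ suc σ) (δ μ′ m)
      by-degree (yes μ≤m) = begin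
        generator F (suc i) u m
          ≈⟨ generator-supported F u μ support (suc i) m μ≤m ⟩
        negPow (suc i) (u μ * coeff (monAt F μ) (suc i) m)
          ≈⟨ negPow-cong (suc i) (*-cong (trans (u≈ μ) (negPow-cong σ (δ-diag μ)))
                                          (coeff-monAt-yz (vertex w) (vertex<S w r) (length w ℕ.* e) i
                                                          (All.head (proj₁ r′)) (vertex<S (i ∷ w) r′) m)) ⟩
        negPow (suc i) (negPow σ 1# * - δ μ′ m)
          ≈⟨ negPow-cong (suc i) (trans (*-comm _ _) (trans (sym (negPow-* σ _ 1#)) (negPow-cong σ (*-identityʳ _)))) ⟩
        negPow (suc i) (negPow σ (- δ μ′ m))
          ≈⟨ negPow-cong (suc i) (negPow-‿ σ _) ⟩
        negPow (suc i) (negPow (suc σ) (δ μ′ m))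
          ≡⟨ negPow-+ℕ (suc i) (suc σ) _ ⟩
        negPow (suc i ℕ.+ suc σ) (δ μ′ m) ∎
      by-degree (no μ≰m) = trans (generator-supported-vanishes F u μ support (suc i) m μ≰m)
                                 (sym (trans (negPow-cong (suc i ℕ.+ suc σ) (δ-off μ′ m μ′≢m)) (negPow-0# (suc i ℕ.+ suc σ))))
        where
        μ′≢m : μ′ ≢ m
        μ′≢m eq = μ≰m (NP.≤-trans (NP.≤-reflexive (degree-yz _ (length w ℕ.* e)))
                        (NP.≤-trans (s≤s (NP.m≤n+m _ e)) (NP.≤-reflexive (P.trans (P.sym (degree-yz _ _)) (P.cong degree eq)))))

    trace : ∀ w (r : InRange w) m → opWord (generator F) w (δ (leaf [] root)) m ≈ negPow (signExponent w) (δ (leaf w r) m)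
    trace []      r m = refl
    trace (i ∷ w) r@(_ ∷ w<MM , s≤s |w|<LL) m = generator-step w r′ i r (signExponent w) _ (trace w r′) m
      where r′ = w<MM , NP.m≤n⇒m≤1+n |w|<LL

    word-at-own-leaf : ∀ w (r : InRange w) → opWord (generator F) w (δ (leaf [] root)) (leaf w r) ≈ negPow (signExponent w) 1#
    word-at-own-leaf w r = trans (trace w r _) (negPow-cong (signExponent w) (δ-diag (leaf w r)))

    word-at-other-leaf : ∀ {w w′} (r : InRange w) (r′ : InRange w′) → w′ ≢ w →
      opWord (generator F) w′ (δ (leaf [] root)) (leaf w r) ≈ 0#
    word-at-other-leaf {w′ = w′} r r′ w′≢w =
      trans (trace w′ r′ _)
            (trans (negPow-cong (signExponent w′) (δ-off _ _ (w′≢w ∘ leaf-injective r′ r))) (negPow-0# (signExponent w′)))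

    𝒮-at-leaf : ∀ P → All (InRange ∘ proj₂) P → ∀ w (r : InRange w) →
      𝒮 (generator F) P (δ (leaf [] root)) (leaf w r) ≈ negPow (signExponent w) (nsCoeff P w)
    𝒮-at-leaf []             []        w r = sym (negPow-0# (signExponent w))
    𝒮-at-leaf ((x , w′) ∷ P) (r′ ∷ rs) w r with LP.≡-dec ℕ._≟_ w′ w
    ... | yes P.refl = begin
      x * opWord (generator F) w u₀ (leaf w r) + 𝒮 (generator F) P u₀ (leaf w r)
        ≈⟨ +-cong (*-congˡ (word-at-own-leaf w r)) (𝒮-at-leaf P rs w r) ⟩
      x * negPow N 1# + negPow N (nsCoeff P w)
        ≈⟨ +-congʳ (trans (sym (negPow-* N x 1#)) (negPow-cong N (*-identityʳ x))) ⟩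
      negPow N x + negPow N (nsCoeff P w)
        ≈⟨ sym (negPow-+ N x _) ⟩
      negPow N (x + nsCoeff P w) ∎
      where
      N = signExponent w
      u₀ = δ (leaf [] root)
    ... | no w′≢w = begin
      x * opWord (generator F) w′ u₀ (leaf w r) + 𝒮 (generator F) P u₀ (leaf w r)
        ≈⟨ +-cong (*-congˡ (word-at-other-leaf r r′ w′≢w)) (𝒮-at-leaf P rs w r) ⟩
      x * 0# + negPow (signExponent w) (nsCoeff P w)
        ≈⟨ trans (+-congʳ (zeroʳ x)) (+-identityˡ _) ⟩
      negPow (signExponent w) (nsCoeff P w) ∎
      where u₀ = δ (leaf [] root)

    F-isGenerator : IsGenerator F (generator F)
    F-isGenerator = generator-isGenerator F t⁰part-F

    nsCoeff-vanishes : ∀ P → All (InRange ∘ proj₂) P → ∀ f → IsGenerator F f → IsZeroOp (𝒮 f P) →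
      ∀ w → InRange w → nsCoeff P w ≈ 0#
    nsCoeff-vanishes P P-in-range f isGen 𝒮f≈0 w r = negPow≈0⇒≈0 (signExponent w) _ (begin
      negPow (signExponent w) (nsCoeff P w)        ≈⟨ sym (𝒮-at-leaf P P-in-range w r) ⟩
      𝒮 (generator F) P (δ (leaf [] root)) (leaf w r) ≈⟨ sym (𝒮-unique F isGen P _ _) ⟩
      𝒮 f P (δ (leaf [] root)) (leaf w r)          ≈⟨ 𝒮f≈0 _ _ ⟩
      0#                                           ∎)

  wordLetterBound : List ℕ → ℕ
  wordLetterBound = foldr (λ i b → suc i ℕ.⊔ b) 0

  letterBound lengthBound : NSym → ℕ
  letterBound = foldr (λ (_ , w) b → wordLetterBound w ℕ.⊔ b) 0
  lengthBound = foldr (λ (_ , w) b → length w ℕ.⊔ b) 0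

  words-bounded : ∀ P → All (λ (_ , w) → All (_< letterBound P) w × length w ≤ lengthBound P) P
  words-bounded P = go P NP.≤-refl NP.≤-refl
    where
    letters-bounded : ∀ w {M} → wordLetterBound w ≤ M → All (_< M) w
    letters-bounded []      _  = []
    letters-bounded (i ∷ w) le =
      NP.≤-trans (NP.m≤m⊔n (suc i) (wordLetterBound w)) le ∷ letters-bounded w (NP.≤-trans (NP.m≤n⊔m (suc i) _) le)
    go : ∀ Q → letterBound Q ≤ letterBound P → lengthBound Q ≤ lengthBound P →
      All (λ (_ , w) → All (_< letterBound P) w × length w ≤ lengthBound P) Q
    go []            _   _   = []
    go ((x , w) ∷ Q) le₁ le₂ =
        (letters-bounded w (NP.≤-trans (NP.m≤m⊔n (wordLetterBound w) (letterBound Q)) le₁)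
         , NP.≤-trans (NP.m≤m⊔n (length w) _) le₂)
      ∷ go Q (NP.≤-trans (NP.m≤n⊔m (wordLetterBound w) (letterBound Q)) le₁) (NP.≤-trans (NP.m≤n⊔m (length w) _) le₂)

  nsCoeff-absent : ∀ P w → All (λ (_ , w′) → w′ ≢ w) P → nsCoeff P w ≈ 0#
  nsCoeff-absent []             w []          = refl
  nsCoeff-absent ((x , w′) ∷ P) w (w′≢w ∷ ne) with LP.≡-dec ℕ._≟_ w′ w
  ... | yes w′≡w = contradiction w′≡w w′≢w
  ... | no _     = nsCoeff-absent P w ne

theorem5p3 : ∀ {a ℓ : Level} (K : CommutativeRing a ℓ) → Over.IsQAlgebra K →
    (α : ℕ) → 1 ≤ α → (c : Case) → (P : Over.NSym K) → Over.NonzeroNSym K P →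
    ∃[ n ] (1 ≤ n × ∃[ B ] ((∃[ f ] Over.IsGenerator K (Over.𝔹.F {c = c} {α = α} {n = n} B) f)
    × (∀ f → Over.IsGenerator K (Over.𝔹.F B) f → ¬ Over.IsZeroOp K (Over.𝒮 K f P))))
theorem5p3 K _ α _ c P P≢0 =
    n , s≤s z≤n , 𝔹-element α (NP.m≤n+m∸n α 1) , (generator K F , F-isGenerator)
  , λ f isGen 𝒮f≈0 → P≢0 (coeffs-vanish f isGen 𝒮f≈0)
  where
  open Over K using (IsGenerator; IsZeroOp; 𝒮; nsCoeff)
  open CommutativeRing K using (_≈_; 0#)
  open Construction K c (letterBound K P) (lengthBound K P) (α ∸ 1)
  coeffs-vanish : ∀ f → IsGenerator F f → IsZeroOp (𝒮 f P) → ∀ w → nsCoeff P w ≈ 0#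
  coeffs-vanish f isGen 𝒮f≈0 w with All.all? (ℕ._<? letterBound K P) w ×-dec (length w ℕ.≤? lengthBound K P)
  ... | yes w-in-range = nsCoeff-vanishes P (words-bounded K P) f isGen 𝒮f≈0 w w-in-range
  ... | no w-out-of-range = nsCoeff-absent K P w (All.map (λ { r P.refl → w-out-of-range r }) (words-bounded K P))
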